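{- Let $x_1,x_2,\dots$ be indeterminates. Then $$\sum_{n\ge0}\sum_{\pi\in\mathfrak M_n}\prod_{j\ge1}x_j^{12\ldots j(\pi)} =\cfrac{1}{1-x_1-\cfrac{x_1^2x_2}{1-x_1x_2-\cfrac{x_1^2x_2^3x_3}{1-x_1x_2^2x_3-\cfrac{x_1^2x_2^5x_3^4x_4}{\ddots}}}},$$ where, writing the continued fraction as $\cfrac{1}{1-a_1-\cfrac{b_1}{1-a_2-\cfrac{b_2}{1-a_3-\cdots}}}$, the $n$-th numerator is $b_n=\prod_{i=1}^{n+1}x_i^{\binom{n}{i-1}+\binom{n-1}{i-1}}$ and $a_n=\prod_{i=1}^{n}x_i^{\binom{n-1}{i-1}}$ for $n\ge1$.
   Context: A permutation $\pi=\pi_1\cdots\pi_n$ is a Motzkin permutation if it avoids the pattern $132$ (no $i<j<k$ with $\pi_i<\pi_k<\pi_j$) and there are no indices $a<b$ with $\pi_a<\pi_b<\pi_{b+1}$; $\mathfrak M_n$ denotes the set of Motzkin permutations of length $n$. For $j\ge1$, $12\ldots j(\pi)$ denotes the number of occurrences of the classical pattern $12\ldots j$ in $\pi$, i.e. the number of index sets $i_1<\dots<i_j$ with $\pi_{i_1}<\dots<\pi_{i_j}$ (so $12\ldots j(\pi)$ for $j=1$ is $n$). -}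

module Defs where

open import Data.Bool using (Bool; true; false; if_then_else_; _∧_; _∨_; not)
open import Data.Nat using (ℕ; zero; suc; _+_; _∸_; _<ᵇ_; _≡ᵇ_)
open import Data.Nat.Combinatorics using (_C_)
open import Data.List using (List; []; _∷_; _++_; map; length; concatMap; upTo; foldr)
open import Data.Bool.ListAction using (any)
import Data.List.Properties as LP
import Data.Nat as N
open import Data.Integer using (ℤ; +_) renaming (_+_ to _+ℤ_; _*_ to _*ℤ_; _-_ to _-ℤ_)
open import Data.Product using (_×_; _,_)
open import Relation.Nullary.Decidable using (⌊_⌋)
open import Relation.Unary using (Decidable)

words : ℕ → ℕ → List (List ℕ)
words zero    k = [] ∷ []
words (suc l) k = concatMap (λ i → map (suc i ∷_) (words l k)) (upTo k)

filterB : (List ℕ → Bool) → List (List ℕ) → List (List ℕ)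
filterB p []       = []
filterB p (x ∷ xs) = if p x then x ∷ filterB p xs else filterB p xs

distinct : List ℕ → Bool
distinct []       = true
distinct (x ∷ xs) = not (any (λ y → x ≡ᵇ y) xs) ∧ distinct xs

-- a word of length n over {1..n} is a permutation iff its entries are distinct;
-- permutations of length n (as words π₁⋯πₙ)
perms : ℕ → List (List ℕ)
perms n = filterB distinct (words n n)

-- all subsequences (one per index set i₁<⋯<iⱼ)
sublists : List ℕ → List (List ℕ)
sublists []       = [] ∷ []
sublists (x ∷ xs) = map (x ∷_) (sublists xs) ++ sublists xs

increasing : List ℕ → Bool
increasing []           = true
increasing (x ∷ [])     = true
increasing (x ∷ y ∷ xs) = (x <ᵇ y) ∧ increasing (y ∷ xs)

countB : (List ℕ → Bool) → List (List ℕ) → ℕ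
countB p []       = 0
countB p (x ∷ xs) = (if p x then 1 else 0) + countB p xs

occInc : ℕ → List ℕ → ℕ
occInc j π = countB (λ s → (length s ≡ᵇ j) ∧ increasing s) (sublists π)

is132 : List ℕ → Bool
is132 (a ∷ b ∷ c ∷ []) = (a <ᵇ c) ∧ (c <ᵇ b)
is132 _                = false

avoids132 : List ℕ → Bool
avoids132 π = not (any is132 (sublists π))

-- there exist a < b with π_a < π_b < π_{b+1}
-- (helper: pre = list of entries strictly before the current position)
bad1-23 : List ℕ → List ℕ → Bool
bad1-23 pre []           = false
bad1-23 pre (u ∷ [])     = false
bad1-23 pre (u ∷ v ∷ xs) =
  ((u <ᵇ v) ∧ any (λ y → y <ᵇ u) pre) ∨ bad1-23 (u ∷ pre) (v ∷ xs)

isMotzkin : List ℕ → Bool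
isMotzkin π = avoids132 π ∧ not (bad1-23 [] π)

-- Monomials in x₁, x₂, … : finite exponent lists (e₁, e₂, …),
-- identified up to trailing zeros

Mon : Set
Mon = List ℕ

strip : Mon → Mon
strip []       = []
strip (x ∷ xs) with strip xs
... | []     = if x ≡ᵇ 0 then [] else x ∷ []
... | y ∷ ys = x ∷ y ∷ ys

monEq : Mon → Mon → Bool
monEq m m' = ⌊ LP.≡-dec N._≟_ (strip m) (strip m') ⌋

exp₁ : Mon → ℕ
exp₁ []      = 0
exp₁ (e ∷ _) = e

totDeg : Mon → ℕ
totDeg = foldr _+_ 0

-- ∏_{j≥1} x_j^{12…j(π)}  (12…j(π) = 0 for j > |π|)
monOf : List ℕ → Mon
monOf π = map (λ j → occInc (suc j) π) (upTo (length π))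

-- coefficient of the monomial m in ∑_{n≥0} ∑_{π∈𝔐ₙ} ∏ x_j^{12…j(π)}
-- (only n = exponent of x₁ in m can contribute, since 1(π) = n)
lhsCoeff : Mon → ℕ
lhsCoeff m = countB (λ π → isMotzkin π ∧ monEq (monOf π) m) (perms (exp₁ m))

Series : Set
Series = Mon → ℤ

sumℤ : List ℤ → ℤ
sumℤ = foldr _+ℤ_ (+ 0)

splits : Mon → List (Mon × Mon)
splits []       = ([] , []) ∷ []
splits (e ∷ m)  =
  concatMap (λ i → map (λ { (d , d') → (i ∷ d , (e ∸ i) ∷ d') }) (splits m)) (upTo (suc e))

_+ˢ_ : Series → Series → Series
(f +ˢ g) m = f m +ℤ g m

_*ˢ_ : Series → Series → Series
(f *ˢ g) m = sumℤ (map (λ { (d , d') → f d *ℤ g d' }) (splits m))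

monoS : Mon → Series
monoS e m = if monEq e m then + 1 else + 0

oneS : Series
oneS = monoS []

_^ˢ_ : Series → ℕ → Series
f ^ˢ zero  = oneS
f ^ˢ suc k = f *ˢ (f ^ˢ k)

-- 1/(1 - g) = ∑_{k≥0} g^k, for a series g with zero constant term;
-- then g^k only has monomials of total degree ≥ k, so the coefficient of m
-- only needs k ≤ totDeg m.
invOneMinus : Series → Series
invOneMinus g m = sumℤ (map (λ k → (g ^ˢ k) m) (upTo (suc (totDeg m))))

aMon : ℕ → Mon
aMon n = map (λ i → (n ∸ 1) C i) (upTo n)

bMon : ℕ → Mon
bMon n = map (λ i → (n C i) + ((n ∸ 1) C i)) (upTo (suc n))

cfTail : ℕ → ℕ → Series
cfTail zero    k = monoS (aMon k)
cfTail (suc d) k = monoS (aMon k) +ˢ (monoS (bMon k) *ˢ invOneMinus (cfTail d (suc k)))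

-- the (d+1)-st convergent  1/(1-a₁-b₁/(1-a₂-⋯-b_d/(1-a_{d+1})))
convergent : ℕ → Series
convergent d = invOneMinus (cfTail d 1)

{-# OPTIONS --safe #-}

-- Cutting a Motzkin permutation of length n+1 at its maximum N leaves either N ρ, or
-- (σ + |ρ| + 1) (|ρ| + 1) N ρ with σ and ρ Motzkin permutations. The first form multiplies the weight
-- of ρ by x₁. In the second, |ρ| + 1 and N contribute x₁²x₂, and every occurrence of 12…j in σ also
-- extends by N to an occurrence of 12…(j+1); on the weight of σ this is the substitution xⱼ ↦ xⱼ xⱼ₊₁.
-- So if Fₖ counts Motzkin permutations with k such substitutions applied to their weight, then
-- Fₖ = 1/(1 - aₖ₊₁ - bₖ₊₁ Fₖ₊₁), where aₖ₊₁ and bₖ₊₁ are x₁ and x₁²x₂ after k substitutions.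
-- Since every bₖ is divisible by x₁², the convergents of the continued fraction agree with F₀ on all
-- monomials of ever higher x₁-degree.
module Submission where

open import Defs
open import Algebra.Properties.CommutativeSemigroup using (interchange)
open import Data.Bool using (Bool; true; false; if_then_else_; _∧_; _∨_; not; T)
open import Data.Bool.ListAction using (any)
open import Data.Bool.Properties using (∧-zeroʳ; ∨-identityʳ; ∨-zeroʳ; ∨-assoc; ∨-comm; T-≡; ⇔→≡)
open import Data.Empty using (⊥-elim)
open import Data.List using (List; []; _∷_; _++_; [_]; map; length; concatMap; upTo; applyUpTo; drop; reverseAcc; initLast; _∷ʳ′_)
open import Data.List.Membership.Propositional using (_∈_; _∉_; find; lose)
open import Data.List.Membership.Propositional.Properties
  using (∈-map⁺; ∈-map⁻; ∈-concatMap⁺; ∈-concatMap⁻; ∈-upTo⁺; ∈-upTo⁻; ∈-∃++; ∈-++⁺ˡ; ∈-++⁺ʳ; ∈-++⁻)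
open import Data.List.Membership.Propositional.Properties.WithK using (unique∧set⇒bag)
import Data.List.Membership.DecPropositional as DecMembership
import Data.List.Properties as List
open import Data.List.Relation.Binary.BagAndSetEquality using (∼bag⇒↭)
import Data.List.Relation.Binary.Permutation.Propositional.Properties as ↭
open import Data.List.Relation.Unary.All as All using (All; []; _∷_)
import Data.List.Relation.Unary.All.Properties as All
open import Data.List.Relation.Unary.AllPairs as AllPairs using ([]; _∷_)
open import Data.List.Relation.Unary.Any using (here; there)
open import Data.List.Relation.Unary.Unique.Propositional using (Unique)
import Data.List.Relation.Unary.Unique.Propositional.Properties as Unique
open import Data.Nat using (ℕ; zero; suc; _+_; _*_; _∸_; _≤_; _<_; _≥_; z≤n; s≤s; _<ᵇ_; _≡ᵇ_)
open import Data.Nat.Combinatorics using (_C_; nCk+nC[k+1]≡[n+1]C[k+1])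
open import Data.Nat.Combinatorics.Specification using (k>n⇒nCk≡0)
open import Data.Nat.ListAction using (sum)
open import Data.Nat.ListAction.Properties using (sum-++; sum-↭)
open import Data.Nat.Properties
open import Data.Product using (_×_; _,_; proj₁; proj₂; ∃; uncurry)
open import Data.Unit using (⊤; tt)
open import Data.Sum using (inj₁; inj₂)
open import Function using (_∘_; mk⇔; Equivalence)
open import Relation.Binary.Definitions using (tri<; tri≈; tri>)
open import Relation.Binary.PropositionalEquality hiding ([_])
open import Relation.Nullary using (yes; no; ¬_)

private
  variable
    A B : Set

+-interchange : ∀ a b c d → (a + b) + (c + d) ≡ (a + c) + (b + d)
+-interchange = interchange +-commutativeSemigroup

*-interchange : ∀ a b c d → (a * b) * (c * d) ≡ (a * c) * (b * d)
*-interchange = interchange *-commutativeSemigroup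

∑ : (A → ℕ) → List A → ℕ
∑ f xs = sum (map f xs)

𝟙 : Bool → ℕ
𝟙 b = if b then 1 else 0

count : (A → Bool) → List A → ℕ
count p = ∑ (λ x → 𝟙 (p x))

countB≡count : ∀ p xs → countB p xs ≡ count p xs
countB≡count p []       = refl
countB≡count p (x ∷ xs) = cong (𝟙 (p x) +_) (countB≡count p xs)

∑-++ : ∀ (f : A → ℕ) xs ys → ∑ f (xs ++ ys) ≡ ∑ f xs + ∑ f ys
∑-++ f xs ys = trans (cong sum (List.map-++ f xs ys)) (sum-++ (map f xs) (map f ys))

∑-map : ∀ (f : B → ℕ) (g : A → B) xs → ∑ f (map g xs) ≡ ∑ (f ∘ g) xs
∑-map f g xs = cong sum (sym (List.map-∘ xs))

∑-concatMap : ∀ (f : B → ℕ) (g : A → List B) xs → ∑ f (concatMap g xs) ≡ ∑ (∑ f ∘ g) xs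
∑-concatMap f g []       = refl
∑-concatMap f g (x ∷ xs) = trans (∑-++ f (g x) (concatMap g xs)) (cong (∑ f (g x) +_) (∑-concatMap f g xs))

∑-cong : ∀ {f g : A → ℕ} xs → (∀ x → f x ≡ g x) → ∑ f xs ≡ ∑ g xs
∑-cong xs f≗g = cong sum (List.map-cong f≗g xs)

∑-cong-All : ∀ {f g : A → ℕ} {xs} → All (λ x → f x ≡ g x) xs → ∑ f xs ≡ ∑ g xs
∑-cong-All eqs = cong sum (List.map-cong-local eqs)

∑-zero-All : ∀ {f : A → ℕ} {xs} → All (λ x → f x ≡ 0) xs → ∑ f xs ≡ 0
∑-zero-All []       = refl
∑-zero-All (e ∷ es) = cong₂ _+_ e (∑-zero-All es)

∑-zero : ∀ (xs : List A) → ∑ (λ _ → 0) xs ≡ 0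
∑-zero xs = ∑-zero-All {xs = xs} (All.tabulate (λ _ → refl))

∑-+ : ∀ (f g : A → ℕ) xs → ∑ (λ x → f x + g x) xs ≡ ∑ f xs + ∑ g xs
∑-+ f g []       = refl
∑-+ f g (x ∷ xs) = trans (cong (f x + g x +_) (∑-+ f g xs)) (+-interchange (f x) (g x) _ _)

∑-*ˡ : ∀ c (f : A → ℕ) xs → ∑ (λ x → c * f x) xs ≡ c * ∑ f xs
∑-*ˡ c f []       = sym (*-zeroʳ c)
∑-*ˡ c f (x ∷ xs) = trans (cong (c * f x +_) (∑-*ˡ c f xs)) (sym (*-distribˡ-+ c (f x) (∑ f xs)))

∑-*ʳ : ∀ c (f : A → ℕ) xs → ∑ (λ x → f x * c) xs ≡ ∑ f xs * c
∑-*ʳ c f []       = refl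
∑-*ʳ c f (x ∷ xs) = trans (cong (f x * c +_) (∑-*ʳ c f xs)) (sym (*-distribʳ-+ c (f x) (∑ f xs)))

∑-comm : ∀ (h : A → B → ℕ) xs ys → ∑ (λ x → ∑ (h x) ys) xs ≡ ∑ (λ y → ∑ (λ x → h x y) xs) ys
∑-comm h []       ys = sym (∑-zero ys)
∑-comm h (x ∷ xs) ys = trans (cong (∑ (h x) ys +_) (∑-comm h xs ys)) (sym (∑-+ (h x) _ ys))

𝟙-∧ : ∀ a b → 𝟙 (a ∧ b) ≡ 𝟙 a * 𝟙 b
𝟙-∧ true  b = sym (+-identityʳ (𝟙 b))
𝟙-∧ false b = refl

count-* : ∀ (p : A → Bool) (q : B → Bool) xs ys →
          count p xs * count q ys ≡ ∑ (λ x → ∑ (λ y → 𝟙 (p x) * 𝟙 (q y)) ys) xs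
count-* p q xs ys = trans (sym (∑-*ʳ (count q ys) (𝟙 ∘ p) xs))
  (∑-cong xs (λ x → sym (∑-*ˡ (𝟙 (p x)) (𝟙 ∘ q) ys)))

count-cong-All : ∀ {p q : A → Bool} {xs} → All (λ x → p x ≡ q x) xs → count p xs ≡ count q xs
count-cong-All eqs = ∑-cong-All (All.map (cong 𝟙) eqs)

count-sameMembers : ∀ (p : A → Bool) {xs ys} → Unique xs → Unique ys →
                    (∀ {z} → z ∈ xs → z ∈ ys) → (∀ {z} → z ∈ ys → z ∈ xs) → count p xs ≡ count p ys
count-sameMembers p ux uy to from =
  sum-↭ (↭.map⁺ (𝟙 ∘ p) (∼bag⇒↭ (unique∧set⇒bag ux uy (mk⇔ to from))))

∑-upTo-suc : ∀ (f : ℕ → ℕ) n → ∑ f (upTo (suc n)) ≡ ∑ f (upTo n) + f n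
∑-upTo-suc f n = begin
  ∑ f (upTo (suc n))        ≡⟨ cong (∑ f) (sym (List.applyUpTo-∷ʳ (λ x → x) n)) ⟩
  ∑ f (upTo n ++ [ n ])     ≡⟨ ∑-++ f (upTo n) [ n ] ⟩
  ∑ f (upTo n) + (f n + 0)  ≡⟨ cong (∑ f (upTo n) +_) (+-identityʳ (f n)) ⟩
  ∑ f (upTo n) + f n        ∎
  where open ≡-Reasoning

∑-upTo-sucˡ : ∀ (f : ℕ → ℕ) n → ∑ f (upTo (suc n)) ≡ f 0 + ∑ (f ∘ suc) (upTo n)
∑-upTo-sucˡ f n = cong (f 0 +_) (trans (cong (∑ f) (sym (List.map-upTo suc n))) (∑-map f suc (upTo n)))

∑-upTo-cong : ∀ {f g : ℕ → ℕ} n → (∀ {i} → i < n → f i ≡ g i) → ∑ f (upTo n) ≡ ∑ g (upTo n)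
∑-upTo-cong n eq = ∑-cong-All (All.tabulate (eq ∘ ∈-upTo⁻))

∑-upTo-δ : ∀ (f : ℕ → ℕ) {a} n → (∀ {i} → i < n → i ≢ a → f i ≡ 0) → a < n → ∑ f (upTo n) ≡ f a
∑-upTo-δ f {a} (suc n) f≡0 a<1+n with a ≟ n
... | yes refl = trans (∑-upTo-suc f n)
  (cong (_+ f a) (trans (∑-upTo-cong n (λ i<n → f≡0 (m≤n⇒m≤1+n i<n) (<⇒≢ i<n))) (∑-zero (upTo n))))
... | no a≢n = begin
  ∑ f (upTo (suc n))      ≡⟨ ∑-upTo-suc f n ⟩
  ∑ f (upTo n) + f n      ≡⟨ cong₂ _+_ (∑-upTo-δ f n (λ i<n → f≡0 (m≤n⇒m≤1+n i<n)) (≤∧≢⇒< (≤-pred a<1+n) a≢n))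
                                      (f≡0 ≤-refl (a≢n ∘ sym)) ⟩
  f a + 0                 ≡⟨ +-identityʳ (f a) ⟩
  f a                     ∎
  where open ≡-Reasoning

∑-upTo-extend : ∀ (f : ℕ → ℕ) {n} N → n ≤ N → (∀ {k} → n ≤ k → k < N → f k ≡ 0) → ∑ f (upTo N) ≡ ∑ f (upTo n)
∑-upTo-extend f zero    z≤n    _   = refl
∑-upTo-extend f {n} (suc N) n≤1+N f≡0 with n ≟ suc N
... | yes refl   = refl
... | no n≢1+N = trans (∑-upTo-suc f N)
  (trans (cong₂ _+_ (∑-upTo-extend f N n≤N (λ n≤k k<N → f≡0 n≤k (m≤n⇒m≤1+n k<N))) (f≡0 n≤N ≤-refl))
         (+-identityʳ _))
  where
  n≤N : n ≤ N
  n≤N = ≤-pred (≤∧≢⇒< n≤1+N n≢1+N)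

bool-ext : ∀ {a b} → (a ≡ true → b ≡ true) → (b ≡ true → a ≡ true) → a ≡ b
bool-ext to from = ⇔→≡ (mk⇔ to from)

true⇒T : ∀ {b} → b ≡ true → T b
true⇒T = Equivalence.from T-≡

T⇒true : ∀ {b} → T b → b ≡ true
T⇒true = Equivalence.to T-≡

contraposeᵇ : ∀ {a b} → (a ≡ true → b ≡ true) → b ≡ false → a ≡ false
contraposeᵇ {false} _    _  = refl
contraposeᵇ {true}  a⇒b b≡f with () ← trans (sym (a⇒b refl)) b≡f

∨-trueˡ : ∀ {a} b → a ≡ true → (a ∨ b) ≡ true
∨-trueˡ b refl = refl

∨-trueʳ : ∀ a {b} → b ≡ true → (a ∨ b) ≡ true
∨-trueʳ a refl = ∨-zeroʳ a

∨-mono : ∀ {a a′ b b′} → (a ≡ true → a′ ≡ true) → (b ≡ true → b′ ≡ true) → (a ∨ b) ≡ true → (a′ ∨ b′) ≡ true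
∨-mono {true}       a⇒a′ _    _  = ∨-trueˡ _ (a⇒a′ refl)
∨-mono {false} {a′} _    b⇒b′ b = ∨-trueʳ a′ (b⇒b′ b)

∧-monoʳ : ∀ a {b b′} → (b ≡ true → b′ ≡ true) → (a ∧ b) ≡ true → (a ∧ b′) ≡ true
∧-monoʳ true b⇒b′ = b⇒b′

≡ᵇ⇒≡′ : ∀ {m n} → (m ≡ᵇ n) ≡ true → m ≡ n
≡ᵇ⇒≡′ {m} {n} e = ≡ᵇ⇒≡ m n (true⇒T e)

≡ᵇ-refl : ∀ n → (n ≡ᵇ n) ≡ true
≡ᵇ-refl n = T⇒true (≡⇒≡ᵇ n n refl)

≢⇒≡ᵇ-false : ∀ {m n} → m ≢ n → (m ≡ᵇ n) ≡ false
≢⇒≡ᵇ-false {m} {n} m≢n with m ≡ᵇ n in eq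
... | true  = ⊥-elim (m≢n (≡ᵇ⇒≡′ eq))
... | false = refl

<⇒<ᵇ′ : ∀ {m n} → m < n → (m <ᵇ n) ≡ true
<⇒<ᵇ′ m<n = T⇒true (<⇒<ᵇ m<n)

≥⇒<ᵇ-false : ∀ {m n} → n ≤ m → (m <ᵇ n) ≡ false
≥⇒<ᵇ-false {m} {n} n≤m with m <ᵇ n in eq
... | false = refl
... | true  = ⊥-elim (≤⇒≯ n≤m (<ᵇ⇒< m n (true⇒T eq)))

<ᵇ-+ʳ : ∀ m n u → (m + u <ᵇ n + u) ≡ (m <ᵇ n)
<ᵇ-+ʳ m n u = bool-ext
  (λ e → <⇒<ᵇ′ (+-cancelʳ-< u m n (<ᵇ⇒< (m + u) (n + u) (true⇒T e))))
  (λ e → <⇒<ᵇ′ (+-monoˡ-< u (<ᵇ⇒< m n (true⇒T e))))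

any-++ : ∀ (p : A → Bool) xs ys → any p (xs ++ ys) ≡ any p xs ∨ any p ys
any-++ p []       ys = refl
any-++ p (x ∷ xs) ys = trans (cong (p x ∨_) (any-++ p xs ys)) (sym (∨-assoc (p x) _ _))

any-map : ∀ (p : B → Bool) (f : A → B) xs → any p (map f xs) ≡ any (p ∘ f) xs
any-map p f []       = refl
any-map p f (x ∷ xs) = cong (p (f x) ∨_) (any-map p f xs)

any-cong : ∀ {p q : A → Bool} xs → (∀ x → p x ≡ q x) → any p xs ≡ any q xs
any-cong []       p≗q = refl
any-cong (x ∷ xs) p≗q = cong₂ _∨_ (p≗q x) (any-cong xs p≗q)

any-false : ∀ (p : A → Bool) xs → (∀ {x} → x ∈ xs → p x ≡ false) → any p xs ≡ false
any-false p []       _  = refl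
any-false p (x ∷ xs) px≡f rewrite px≡f (here refl) = any-false p xs (px≡f ∘ there)

any-true : ∀ (p : A → Bool) {x} xs → x ∈ xs → p x ≡ true → any p xs ≡ true
any-true p (y ∷ xs) (here refl) px = ∨-trueˡ _ px
any-true p (y ∷ xs) (there x∈)  px = ∨-trueʳ (p y) (any-true p xs x∈ px)

any-witness : ∀ (p : A → Bool) xs → any p xs ≡ true → ∃ λ x → x ∈ xs × p x ≡ true
any-witness p (x ∷ xs) e with p x in px
... | true  = x , here refl , px
... | false = let y , y∈ , py = any-witness p xs e in y , there y∈ , py

any-⊆ : ∀ (p : A → Bool) {xs ys} → (∀ {z} → z ∈ xs → z ∈ ys) → any p xs ≡ true → any p ys ≡ true
any-⊆ p {xs} {ys} xs⊆ys e = let z , z∈ , pz = any-witness p xs e in any-true p ys (xs⊆ys z∈) pz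

Unique-++ˡ : ∀ (xs : List A) {ys} → Unique (xs ++ ys) → Unique xs
Unique-++ˡ []       _        = []
Unique-++ˡ (x ∷ xs) (x∉ ∷ u) = All.++⁻ˡ xs x∉ ∷ Unique-++ˡ xs u

Unique-++ʳ : ∀ (xs : List A) {ys} → Unique (xs ++ ys) → Unique ys
Unique-++ʳ []       u       = u
Unique-++ʳ (x ∷ xs) (_ ∷ u) = Unique-++ʳ xs u

Unique-++-disjoint : ∀ (xs : List A) {ys x y} → Unique (xs ++ ys) → x ∈ xs → y ∈ ys → x ≢ y
Unique-++-disjoint (x ∷ xs) (x∉ ∷ _) (here refl) y∈ = All.lookup x∉ (∈-++⁺ʳ xs y∈)
Unique-++-disjoint (x ∷ xs) (_ ∷ u)  (there x∈)  y∈ = Unique-++-disjoint xs u x∈ y∈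

Unique-concatMap : ∀ {I : Set} (g : I → List A) (key : A → I) {is} → Unique is → (∀ i → Unique (g i)) →
                   (∀ {i y} → y ∈ g i → key y ≡ i) → Unique (concatMap g is)
Unique-concatMap g key {[]}     _        _  _   = []
Unique-concatMap g key {i ∷ is} (i∉ ∷ u) ug key≡ = Unique.++⁺ (ug i) (Unique-concatMap g key u ug key≡) disjoint
  where
  disjoint : ∀ {v} → ¬ (v ∈ g i × v ∈ concatMap g is)
  disjoint (v∈gi , v∈rest) = let j , j∈ , v∈gj = find (∈-concatMap⁻ g {xs = is} v∈rest)
                             in All.lookup i∉ j∈ (trans (sym (key≡ v∈gi)) (key≡ v∈gj))

Unique-map-on : ∀ (f : A → B) {xs} → (∀ {x y} → x ∈ xs → y ∈ xs → f x ≡ f y → x ≡ y) → Unique xs → Unique (map f xs)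
Unique-map-on f {[]}     _   _        = []
Unique-map-on f {x ∷ xs} inj (x∉ ∷ u) =
  All.map⁺ (All.tabulate (λ y∈ fx≡fy → All.lookup x∉ y∈ (inj (here refl) (there y∈) fx≡fy)))
  ∷ Unique-map-on f (λ x∈ y∈ → inj (there x∈) (there y∈)) u

Unique-remove : ∀ (ys₁ : List A) {x} ys₂ → Unique (ys₁ ++ x ∷ ys₂) → Unique (ys₁ ++ ys₂) × x ∉ ys₁ ++ ys₂
Unique-remove []        ys₂ (x∉ ∷ u) = u , λ x∈ → All.lookup x∉ x∈ refl
Unique-remove (y ∷ ys₁) {x} ys₂ (y∉ ∷ u) with Unique-remove ys₁ ys₂ u
... | u′ , x∉ = All.tabulate (All.lookup y∉ ∘ skip) ∷ u′ , x∉′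
  where
  skip : ∀ {z} → z ∈ ys₁ ++ ys₂ → z ∈ ys₁ ++ x ∷ ys₂
  skip z∈ with ∈-++⁻ ys₁ z∈
  ... | inj₁ z∈₁ = ∈-++⁺ˡ z∈₁
  ... | inj₂ z∈₂ = ∈-++⁺ʳ ys₁ (there z∈₂)
  x∉′ : x ∉ y ∷ ys₁ ++ ys₂
  x∉′ (here refl) = All.lookup y∉ (∈-++⁺ʳ ys₁ (here refl)) refl
  x∉′ (there x∈)  = x∉ x∈

Unique-bounded-length : ∀ {a} b xs → Unique xs → All (λ x → a ≤ x × x < b) xs → length xs ≤ b ∸ a
Unique-bounded-length zero    []       _ _              = z≤n
Unique-bounded-length zero    (_ ∷ _)  _ ((_ , ()) ∷ _)
Unique-bounded-length {a} (suc b) xs u bounds with DecMembership._∈?_ _≟_ b xs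
... | no b∉ = ≤-trans (Unique-bounded-length b xs u (All.tabulate below-b)) (∸-monoˡ-≤ a (n≤1+n b))
  where
  below-b : ∀ {x} → x ∈ xs → a ≤ x × x < b
  below-b {x} x∈ = let a≤x , x<1+b = All.lookup bounds x∈
                   in a≤x , ≤∧≢⇒< (≤-pred x<1+b) (λ x≡b → b∉ (subst (_∈ xs) x≡b x∈))
... | yes b∈ with ∈-∃++ b∈
... | p , q , refl with Unique-remove p q u
... | u′ , b∉ = begin
  length (p ++ b ∷ q)      ≡⟨ List.length-++ p ⟩
  length p + suc (length q) ≡⟨ +-suc (length p) (length q) ⟩
  suc (length p + length q) ≡⟨ cong suc (List.length-++ p) ⟨
  suc (length (p ++ q))    ≤⟨ s≤s (Unique-bounded-length b (p ++ q) u′ (All.tabulate below-b)) ⟩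
  suc (b ∸ a)              ≡⟨ +-∸-assoc 1 a≤b ⟨
  suc b ∸ a                ∎
  where
  open ≤-Reasoning
  a≤b : a ≤ b
  a≤b = proj₁ (All.lookup bounds (∈-++⁺ʳ p (here refl)))
  keep : ∀ {z} → z ∈ p ++ q → z ∈ p ++ b ∷ q
  keep z∈ with ∈-++⁻ p z∈
  ... | inj₁ z∈p = ∈-++⁺ˡ z∈p
  ... | inj₂ z∈q = ∈-++⁺ʳ p (there z∈q)
  below-b : ∀ {x} → x ∈ p ++ q → a ≤ x × x < b
  below-b {x} x∈ = let a≤x , x<1+b = All.lookup bounds (keep x∈)
                   in a≤x , ≤∧≢⇒< (≤-pred x<1+b) (λ x≡b → b∉ (subst (_∈ p ++ q) x≡b x∈))

deg : ℕ → Mon → ℕ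
deg t       []       = 0
deg zero    (e ∷ _)  = e
deg (suc t) (_ ∷ es) = deg t es

deg-drop : ∀ t u → deg (suc t) u ≡ deg t (drop 1 u)
deg-drop t []      = refl
deg-drop t (_ ∷ _) = refl

exp₁≡deg₀ : ∀ u → exp₁ u ≡ deg 0 u
exp₁≡deg₀ []      = refl
exp₁≡deg₀ (_ ∷ _) = refl

deg₀≤totDeg : ∀ u → deg 0 u ≤ totDeg u
deg₀≤totDeg []      = z≤n
deg₀≤totDeg (e ∷ u) = m≤m+n e _

record _≋_ (u v : Mon) : Set where
  constructor mk≋
  field deg-≡ : ∀ t → deg t u ≡ deg t v
open _≋_ public

infix 4 _≋_

≋-refl : ∀ {u} → u ≋ u
≋-refl = mk≋ (λ _ → refl)

≋-sym : ∀ {u v} → u ≋ v → v ≋ u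
≋-sym u≋v = mk≋ (sym ∘ deg-≡ u≋v)

≋-trans : ∀ {u v w} → u ≋ v → v ≋ w → u ≋ w
≋-trans u≋v v≋w = mk≋ (λ t → trans (deg-≡ u≋v t) (deg-≡ v≋w t))

stripCons : ℕ → Mon → Mon
stripCons e []       = if e ≡ᵇ 0 then [] else e ∷ []
stripCons e (f ∷ fs) = e ∷ f ∷ fs

strip-∷ : ∀ e u → strip (e ∷ u) ≡ stripCons e (strip u)
strip-∷ e u with strip u
... | []    = refl
... | _ ∷ _ = refl

deg-stripCons : ∀ t e u → deg t (stripCons e u) ≡ deg t (e ∷ u)
deg-stripCons zero    zero    [] = refl
deg-stripCons (suc t) zero    [] = refl
deg-stripCons t       (suc e) [] = refl
deg-stripCons t       e (_ ∷ _) = refl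

deg-strip : ∀ t u → deg t (strip u) ≡ deg t u
deg-strip t       []      = refl
deg-strip t       (e ∷ u) rewrite strip-∷ e u = trans (deg-stripCons t e (strip u)) (tail-strip t)
  where
  tail-strip : ∀ t → deg t (e ∷ strip u) ≡ deg t (e ∷ u)
  tail-strip zero    = refl
  tail-strip (suc t) = deg-strip t u

≋⇒strip≡ : ∀ u v → u ≋ v → strip u ≡ strip v
≋⇒strip≡ []      []      _ = refl
≋⇒strip≡ []      (f ∷ v) (mk≋ eq)
  rewrite strip-∷ f v | sym (eq 0) | sym (≋⇒strip≡ [] v (mk≋ (eq ∘ suc))) = refl
≋⇒strip≡ (e ∷ u) []      (mk≋ eq)
  rewrite strip-∷ e u | eq 0 | ≋⇒strip≡ u [] (mk≋ (eq ∘ suc)) = refl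
≋⇒strip≡ (e ∷ u) (f ∷ v) (mk≋ eq)
  rewrite strip-∷ e u | strip-∷ f v | eq 0 | ≋⇒strip≡ u v (mk≋ (eq ∘ suc)) = refl

strip≡⇒≋ : ∀ u v → strip u ≡ strip v → u ≋ v
strip≡⇒≋ u v eq = mk≋ (λ t → trans (sym (deg-strip t u)) (trans (cong (deg t) eq) (deg-strip t v)))

≋⇒monEq : ∀ u v → u ≋ v → monEq u v ≡ true
≋⇒monEq u v u≋v with List.≡-dec _≟_ (strip u) (strip v)
... | yes _   = refl
... | no  ≢ = ⊥-elim (≢ (≋⇒strip≡ u v u≋v))

monEq⇒≋ : ∀ u v → monEq u v ≡ true → u ≋ v
monEq⇒≋ u v e with List.≡-dec _≟_ (strip u) (strip v)
... | yes eq = strip≡⇒≋ u v eq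

monEq-cong : ∀ {u u′ v v′} → u ≋ u′ → v ≋ v′ → monEq u v ≡ monEq u′ v′
monEq-cong {u} {u′} {v} {v′} u≋u′ v≋v′ = bool-ext
  (λ e → ≋⇒monEq u′ v′ (≋-trans (≋-sym u≋u′) (≋-trans (monEq⇒≋ u v e) v≋v′)))
  (λ e → ≋⇒monEq u v (≋-trans u≋u′ (≋-trans (monEq⇒≋ u′ v′ e) (≋-sym v≋v′))))

monEq-congˡ : ∀ {u u′} v → u ≋ u′ → monEq u v ≡ monEq u′ v
monEq-congˡ v u≋u′ = monEq-cong u≋u′ (≋-refl {v})

monEq⇒deg₀≡ : ∀ u v → monEq u v ≡ true → deg 0 u ≡ deg 0 v
monEq⇒deg₀≡ u v e = deg-≡ (monEq⇒≋ u v e) 0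

monEq-∷ : ∀ u e v → monEq u (e ∷ v) ≡ (deg 0 u ≡ᵇ e) ∧ monEq (drop 1 u) v
monEq-∷ u e v = bool-ext to from
  where
  to : monEq u (e ∷ v) ≡ true → ((deg 0 u ≡ᵇ e) ∧ monEq (drop 1 u) v) ≡ true
  to eq with monEq⇒≋ u (e ∷ v) eq
  ... | u≋ rewrite deg-≡ u≋ 0 | ≡ᵇ-refl e =
    ≋⇒monEq (drop 1 u) v (mk≋ (λ t → trans (sym (deg-drop t u)) (deg-≡ u≋ (suc t))))
  from : ((deg 0 u ≡ᵇ e) ∧ monEq (drop 1 u) v) ≡ true → monEq u (e ∷ v) ≡ true
  from eq with deg 0 u ≡ᵇ e in head
  ... | true = ≋⇒monEq u (e ∷ v) (mk≋ degs)
    where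
    degs : ∀ t → deg t u ≡ deg t (e ∷ v)
    degs zero    = ≡ᵇ⇒≡′ head
    degs (suc t) = trans (deg-drop t u) (deg-≡ (monEq⇒≋ (drop 1 u) v eq) t)

infixl 7 _·_

_·_ : Mon → Mon → Mon
[]      · v       = v
(e ∷ u) · []      = e ∷ u
(e ∷ u) · (f ∷ v) = e + f ∷ u · v

deg-· : ∀ t u v → deg t (u · v) ≡ deg t u + deg t v
deg-· t       []      v       = refl
deg-· t       (e ∷ u) []      = sym (+-identityʳ _)
deg-· zero    (e ∷ u) (f ∷ v) = refl
deg-· (suc t) (e ∷ u) (f ∷ v) = deg-· t u v

·-cong : ∀ {u u′ v v′} → u ≋ u′ → v ≋ v′ → u · v ≋ u′ · v′
·-cong {u} {u′} {v} {v′} u≋u′ v≋v′ = mk≋ (λ t →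
  trans (deg-· t u v) (trans (cong₂ _+_ (deg-≡ u≋u′ t) (deg-≡ v≋v′ t)) (sym (deg-· t u′ v′))))

drop-· : ∀ u v → drop 1 (u · v) ≋ drop 1 u · drop 1 v
drop-· []      v       = ≋-refl
drop-· (e ∷ u) []      = mk≋ (λ t → sym (trans (deg-· t u []) (+-identityʳ _)))
drop-· (e ∷ u) (f ∷ v) = ≋-refl

x₁ : Mon
x₁ = 1 ∷ []

x₁²x₂ : Mon
x₁²x₂ = 2 ∷ 1 ∷ []

-- The substitution xⱼ ↦ xⱼ xⱼ₊₁.
shift : Mon → Mon
shift u = u · (0 ∷ u)

degBefore : ℕ → Mon → ℕ
degBefore zero    _ = 0
degBefore (suc t) u = deg t u

deg-shift : ∀ t u → deg t (shift u) ≡ deg t u + degBefore t u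
deg-shift zero    u = deg-· 0 u (0 ∷ u)
deg-shift (suc t) u = deg-· (suc t) u (0 ∷ u)

deg₀-shift : ∀ u → deg 0 (shift u) ≡ deg 0 u
deg₀-shift u = trans (deg-shift 0 u) (+-identityʳ _)

shift-cong : ∀ {u v} → u ≋ v → shift u ≋ shift v
shift-cong {u} {v} u≋v = ·-cong u≋v (mk≋ degs)
  where
  degs : ∀ t → deg t (0 ∷ u) ≡ deg t (0 ∷ v)
  degs zero    = refl
  degs (suc t) = deg-≡ u≋v t

shift-· : ∀ u v → shift (u · v) ≋ shift u · shift v
shift-· u v = mk≋ degs
  where
  degs : ∀ t → deg t (shift (u · v)) ≡ deg t (shift u · shift v)
  degs t = begin
    deg t (shift (u · v))                                  ≡⟨ deg-shift t (u · v) ⟩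
    deg t (u · v) + degBefore t (u · v)                    ≡⟨ cong₂ _+_ (deg-· t u v) (before t) ⟩
    (deg t u + deg t v) + (degBefore t u + degBefore t v)  ≡⟨ +-interchange (deg t u) (deg t v) _ _ ⟩
    (deg t u + degBefore t u) + (deg t v + degBefore t v)  ≡⟨ cong₂ _+_ (deg-shift t u) (deg-shift t v) ⟨
    deg t (shift u) + deg t (shift v)                      ≡⟨ deg-· t (shift u) (shift v) ⟨
    deg t (shift u · shift v)                              ∎
    where
    open ≡-Reasoning
    before : ∀ t → degBefore t (u · v) ≡ degBefore t u + degBefore t v
    before zero    = refl
    before (suc t) = deg-· t u v

shift^ : ℕ → Mon → Mon
shift^ zero    u = u
shift^ (suc k) u = shift^ k (shift u)

shift^-cong : ∀ k {u v} → u ≋ v → shift^ k u ≋ shift^ k v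
shift^-cong zero    u≋v = u≋v
shift^-cong (suc k) u≋v = shift^-cong k (shift-cong u≋v)

shift^-· : ∀ k u v → shift^ k (u · v) ≋ shift^ k u · shift^ k v
shift^-· zero    u v = ≋-refl
shift^-· (suc k) u v = ≋-trans (shift^-cong k (shift-· u v)) (shift^-· k (shift u) (shift v))

shift^-suc : ∀ k u → shift^ (suc k) u ≋ shift (shift^ k u)
shift^-suc zero    u = ≋-refl
shift^-suc (suc k) u = shift^-suc k (shift u)

deg₀-shift^ : ∀ k u → deg 0 (shift^ k u) ≡ deg 0 u
deg₀-shift^ zero    u = refl
deg₀-shift^ (suc k) u = trans (deg₀-shift^ k (shift u)) (deg₀-shift u)

shift^-[] : ∀ k → shift^ k [] ≋ []
shift^-[] zero    = ≋-refl
shift^-[] (suc k) = ≋-trans (shift^-cong k (mk≋ (λ t → trans (deg-shift t []) (shift-[] t)))) (shift^-[] k)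
  where
  shift-[] : ∀ t → deg t [] + degBefore t [] ≡ 0
  shift-[] zero    = refl
  shift-[] (suc t) = refl

deg-shift^-x₁ : ∀ k t → deg t (shift^ k x₁) ≡ k C t
deg-shift^-x₁ zero    zero    = refl
deg-shift^-x₁ zero    (suc t) = refl
deg-shift^-x₁ (suc k) t = trans (deg-≡ (shift^-suc k x₁) t) (trans (deg-shift t (shift^ k x₁)) (pascal t))
  where
  pascal : ∀ t → deg t (shift^ k x₁) + degBefore t (shift^ k x₁) ≡ suc k C t
  pascal zero    = trans (+-identityʳ _) (deg-shift^-x₁ k zero)
  pascal (suc t) = begin
    deg (suc t) (shift^ k x₁) + deg t (shift^ k x₁) ≡⟨ cong₂ _+_ (deg-shift^-x₁ k (suc t)) (deg-shift^-x₁ k t) ⟩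
    k C suc t + k C t                               ≡⟨ +-comm (k C suc t) (k C t) ⟩
    k C t + k C suc t                               ≡⟨ nCk+nC[k+1]≡[n+1]C[k+1] k t ⟩
    suc k C suc t                                   ∎
    where open ≡-Reasoning

deg-upTo : ∀ (f : ℕ → ℕ) n t → (∀ {t} → n ≤ t → f t ≡ 0) → deg t (map f (upTo n)) ≡ f t
deg-upTo f n t f≡0 = trans (cong (deg t) (List.map-upTo f n)) (deg-applyUpTo f n t f≡0)
  where
  deg-applyUpTo : ∀ (f : ℕ → ℕ) n t → (∀ {t} → n ≤ t → f t ≡ 0) → deg t (applyUpTo f n) ≡ f t
  deg-applyUpTo f zero    t       f≡0 = sym (f≡0 z≤n)
  deg-applyUpTo f (suc n) zero    f≡0 = refl
  deg-applyUpTo f (suc n) (suc t) f≡0 = deg-applyUpTo (f ∘ suc) n t (f≡0 ∘ s≤s)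

deg-aMon : ∀ k t → deg t (aMon (suc k)) ≡ k C t
deg-aMon k t = deg-upTo (k C_) (suc k) t (λ k<t → k>n⇒nCk≡0 k<t)

deg-bMon : ∀ k t → deg t (bMon (suc k)) ≡ suc k C t + k C t
deg-bMon k t = deg-upTo (λ i → suc k C i + k C i) (suc (suc k)) t
  (λ 1+k<t → cong₂ _+_ (k>n⇒nCk≡0 1+k<t) (k>n⇒nCk≡0 (<-trans (n<1+n k) 1+k<t)))

aMon≋shift^x₁ : ∀ k → aMon (suc k) ≋ shift^ k x₁
aMon≋shift^x₁ k = mk≋ (λ t → trans (deg-aMon k t) (sym (deg-shift^-x₁ k t)))

-- x₁²x₂ = x₁ · shift x₁.
bMon≋shift^x₁²x₂ : ∀ k → bMon (suc k) ≋ shift^ k x₁²x₂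
bMon≋shift^x₁²x₂ k = mk≋ (λ t → begin
  deg t (bMon (suc k))                               ≡⟨ deg-bMon k t ⟩
  suc k C t + k C t                                  ≡⟨ +-comm (suc k C t) (k C t) ⟩
  k C t + suc k C t                                  ≡⟨ cong₂ _+_ (deg-shift^-x₁ k t) (deg-shift^-x₁ (suc k) t) ⟨
  deg t (shift^ k x₁) + deg t (shift^ (suc k) x₁)    ≡⟨ deg-· t (shift^ k x₁) (shift^ k (shift x₁)) ⟨
  deg t (shift^ k x₁ · shift^ k (shift x₁))          ≡⟨ deg-≡ (shift^-· k x₁ (shift x₁)) t ⟨
  deg t (shift^ k x₁²x₂)                             ∎)
  where open ≡-Reasoning

deg₀-aMon : ∀ k → deg 0 (aMon (suc k)) ≡ 1
deg₀-aMon k = deg-aMon k 0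

deg₀-bMon : ∀ k → deg 0 (bMon (suc k)) ≡ 2
deg₀-bMon k = deg-bMon k 0

Seriesᴺ : Set
Seriesᴺ = Mon → ℕ

monoᴺ : Mon → Seriesᴺ
monoᴺ e m = 𝟙 (monEq e m)

oneᴺ : Seriesᴺ
oneᴺ = monoᴺ []

monoᴺ-deg₀≢ : ∀ e d → deg 0 e ≢ deg 0 d → monoᴺ e d ≡ 0
monoᴺ-deg₀≢ e d e≢d with monEq e d in e≡d
... | false = refl
... | true  = ⊥-elim (e≢d (monEq⇒deg₀≡ e d e≡d))

infixl 6 _+ᴺ_
infixl 7 _*ᴺ_

_+ᴺ_ : Seriesᴺ → Seriesᴺ → Seriesᴺ
(f +ᴺ g) m = f m + g m

_*ᴺ_ : Seriesᴺ → Seriesᴺ → Seriesᴺ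
(f *ᴺ g) m = ∑ (λ p → f (proj₁ p) * g (proj₂ p)) (splits m)

_^ᴺ_ : Seriesᴺ → ℕ → Seriesᴺ
g ^ᴺ zero  = oneᴺ
g ^ᴺ suc k = g *ᴺ g ^ᴺ k

invOneMinusᴺ : Seriesᴺ → Seriesᴺ
invOneMinusᴺ g m = ∑ (λ k → (g ^ᴺ k) m) (upTo (suc (totDeg m)))

record IsSplit (m : Mon) (p : Mon × Mon) : Set where
  constructor mkSplit
  field
    deg₀-sum   : deg 0 (proj₁ p) + deg 0 (proj₂ p) ≡ deg 0 m
    totDeg-sum : totDeg (proj₁ p) + totDeg (proj₂ p) ≡ totDeg m

∑-splits-∷ : ∀ (h : Mon × Mon → ℕ) e m → ∑ h (splits (e ∷ m)) ≡
             ∑ (λ i → ∑ (λ p → h (i ∷ proj₁ p , (e ∸ i) ∷ proj₂ p)) (splits m)) (upTo (suc e))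
∑-splits-∷ h e m = trans (∑-concatMap h (λ i → map (λ p → (i ∷ proj₁ p , (e ∸ i) ∷ proj₂ p)) (splits m)) (upTo (suc e)))
  (∑-cong (upTo (suc e)) (λ i → ∑-map h (λ p → (i ∷ proj₁ p , (e ∸ i) ∷ proj₂ p)) (splits m)))

splits-IsSplit : ∀ m → All (IsSplit m) (splits m)
splits-IsSplit []      = mkSplit refl refl ∷ []
splits-IsSplit (e ∷ m) = All.concat⁺ (All.map⁺ (All.applyUpTo⁺₁ (λ x → x) (suc e)
  (λ i<1+e → All.map⁺ (All.map (λ {p} → cons (≤-pred i<1+e) p) (splits-IsSplit m)))))
  where
  cons : ∀ {i} → i ≤ e → ∀ p → IsSplit m p → IsSplit (e ∷ m) (_ ∷ proj₁ p , (e ∸ i) ∷ proj₂ p)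
  cons {i} i≤e (d , d′) (mkSplit _ tot) =
    mkSplit (m+[n∸m]≡n i≤e) (trans (+-interchange i (totDeg d) (e ∸ i) (totDeg d′)) (cong₂ _+_ (m+[n∸m]≡n i≤e) tot))

*ᴺ-cong-split : ∀ {f g f′ g′ : Seriesᴺ} m →
  (∀ d d′ → IsSplit m (d , d′) → f d * g d′ ≡ f′ d * g′ d′) → (f *ᴺ g) m ≡ (f′ *ᴺ g′) m
*ᴺ-cong-split m eq = ∑-cong-All (All.map (λ {p} → eq (proj₁ p) (proj₂ p)) (splits-IsSplit m))

*ᴺ-zero-split : ∀ {f g : Seriesᴺ} m → (∀ d d′ → IsSplit m (d , d′) → f d * g d′ ≡ 0) → (f *ᴺ g) m ≡ 0
*ᴺ-zero-split m eq = ∑-zero-All (All.map (λ {p} → eq (proj₁ p) (proj₂ p)) (splits-IsSplit m))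

*ᴺ-cong : ∀ {f g f′ g′ : Seriesᴺ} → (∀ d → f d ≡ f′ d) → (∀ d → g d ≡ g′ d) → ∀ m → (f *ᴺ g) m ≡ (f′ *ᴺ g′) m
*ᴺ-cong {f} {g} {f′} {g′} f≗f′ g≗g′ m = *ᴺ-cong-split {f} {g} {f′} {g′} m (λ d d′ _ → cong₂ _*_ (f≗f′ d) (g≗g′ d′))

*ᴺ-distribʳ-+ᴺ : ∀ f₁ f₂ g m → ((f₁ +ᴺ f₂) *ᴺ g) m ≡ (f₁ *ᴺ g) m + (f₂ *ᴺ g) m
*ᴺ-distribʳ-+ᴺ f₁ f₂ g m = trans (∑-cong (splits m) (λ p → *-distribʳ-+ (g (proj₂ p)) (f₁ (proj₁ p)) (f₂ (proj₁ p))))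
  (∑-+ (λ p → f₁ (proj₁ p) * g (proj₂ p)) (λ p → f₂ (proj₁ p) * g (proj₂ p)) (splits m))

monoᴺ-*ᴺ-below : ∀ e g m → deg 0 m < deg 0 e → (monoᴺ e *ᴺ g) m ≡ 0
monoᴺ-*ᴺ-below e g m m<e = *ᴺ-zero-split {monoᴺ e} {g} m vanish
  where
  vanish : ∀ d d′ → IsSplit m (d , d′) → monoᴺ e d * g d′ ≡ 0
  vanish d _ (mkSplit deg₀ _) with monEq e d in e≡d
  ... | false = refl
  ... | true  = ⊥-elim (<⇒≱ m<e (begin
    deg 0 e            ≡⟨ monEq⇒deg₀≡ e d e≡d ⟩
    deg 0 d            ≤⟨ m≤m+n _ _ ⟩
    deg 0 d + _        ≡⟨ deg₀ ⟩
    deg 0 m            ∎))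
    where open ≤-Reasoning

𝟙-monEq-[] : ∀ u v → 𝟙 (monEq u []) * 𝟙 (monEq v []) ≡ 𝟙 (monEq (u · v) [])
𝟙-monEq-[] u v = trans (sym (𝟙-∧ (monEq u []) (monEq v []))) (cong 𝟙 (bool-ext to from))
  where
  deg≡0 : ∀ w → monEq w [] ≡ true → ∀ t → deg t w ≡ 0
  deg≡0 w e = deg-≡ (monEq⇒≋ w [] e)
  to : (monEq u [] ∧ monEq v []) ≡ true → monEq (u · v) [] ≡ true
  to e with monEq u [] in u≡1 | monEq v [] in v≡1
  to refl | true | true = ≋⇒monEq (u · v) [] (mk≋ (λ t →
    trans (deg-· t u v) (cong₂ _+_ (deg≡0 u u≡1 t) (deg≡0 v v≡1 t))))
  to () | true | false
  from : monEq (u · v) [] ≡ true → (monEq u [] ∧ monEq v []) ≡ true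
  from e rewrite ≋⇒monEq u [] (mk≋ (λ t → m+n≡0⇒m≡0 (deg t u) (trans (sym (deg-· t u v)) (deg≡0 (u · v) e t))))
               | ≋⇒monEq v [] (mk≋ (λ t → m+n≡0⇒n≡0 (deg t u) (trans (sym (deg-· t u v)) (deg≡0 (u · v) e t)))) = refl

∑-𝟙[a≡i]𝟙[b≡e∸i] : ∀ a b e → ∑ (λ i → 𝟙 (a ≡ᵇ i) * 𝟙 (b ≡ᵇ (e ∸ i))) (upTo (suc e)) ≡ 𝟙 (a + b ≡ᵇ e)
∑-𝟙[a≡i]𝟙[b≡e∸i] a b e with a ≤? e
... | yes a≤e = trans (∑-upTo-δ _ (suc e) off (s≤s a≤e))
  (trans (cong (λ x → 𝟙 x * 𝟙 (b ≡ᵇ (e ∸ a))) (≡ᵇ-refl a)) (trans (+-identityʳ _) (cong 𝟙 (bool-ext to from))))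
  where
  off : ∀ {i} → i < suc e → i ≢ a → 𝟙 (a ≡ᵇ i) * 𝟙 (b ≡ᵇ (e ∸ i)) ≡ 0
  off {i} _ i≢a rewrite ≢⇒≡ᵇ-false (i≢a ∘ sym) = refl
  to : (b ≡ᵇ (e ∸ a)) ≡ true → (a + b ≡ᵇ e) ≡ true
  to h rewrite ≡ᵇ⇒≡′ {b} h | m+[n∸m]≡n a≤e = ≡ᵇ-refl e
  from : (a + b ≡ᵇ e) ≡ true → (b ≡ᵇ (e ∸ a)) ≡ true
  from h rewrite sym (≡ᵇ⇒≡′ {a + b} h) | m+n∸m≡n a b = ≡ᵇ-refl b
... | no a≰e = trans (trans (∑-upTo-cong (suc e) off) (∑-zero (upTo (suc e))))
  (cong 𝟙 (sym (≢⇒≡ᵇ-false (λ a+b≡e → a≰e (subst (a ≤_) a+b≡e (m≤m+n a b))))))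
  where
  off : ∀ {i} → i < suc e → 𝟙 (a ≡ᵇ i) * 𝟙 (b ≡ᵇ (e ∸ i)) ≡ 0
  off {i} i<1+e rewrite ≢⇒≡ᵇ-false {a} {i} (λ a≡i → a≰e (subst (_≤ e) (sym a≡i) (≤-pred i<1+e))) = refl

∑-splits-monEq : ∀ m u v → ∑ (λ p → 𝟙 (monEq u (proj₁ p)) * 𝟙 (monEq v (proj₂ p))) (splits m) ≡ 𝟙 (monEq (u · v) m)
∑-splits-monEq []      u v = trans (+-identityʳ _) (𝟙-monEq-[] u v)
∑-splits-monEq (e ∷ m) u v = begin
  ∑ (λ p → 𝟙 (monEq u (proj₁ p)) * 𝟙 (monEq v (proj₂ p))) (splits (e ∷ m))
    ≡⟨ ∑-splits-∷ _ e m ⟩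
  ∑ (λ i → ∑ (λ p → 𝟙 (monEq u (i ∷ proj₁ p)) * 𝟙 (monEq v ((e ∸ i) ∷ proj₂ p))) (splits m)) (upTo (suc e))
    ≡⟨ ∑-cong (upTo (suc e)) column ⟩
  ∑ (λ i → heads i * 𝟙 (monEq (drop 1 u · drop 1 v) m)) (upTo (suc e))
    ≡⟨ ∑-*ʳ _ heads (upTo (suc e)) ⟩
  ∑ heads (upTo (suc e)) * 𝟙 (monEq (drop 1 u · drop 1 v) m)
    ≡⟨ cong (_* 𝟙 (monEq (drop 1 u · drop 1 v) m)) (∑-𝟙[a≡i]𝟙[b≡e∸i] (deg 0 u) (deg 0 v) e) ⟩
  𝟙 (deg 0 u + deg 0 v ≡ᵇ e) * 𝟙 (monEq (drop 1 u · drop 1 v) m)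
    ≡⟨ 𝟙-∧ (deg 0 u + deg 0 v ≡ᵇ e) _ ⟨
  𝟙 ((deg 0 u + deg 0 v ≡ᵇ e) ∧ monEq (drop 1 u · drop 1 v) m)
    ≡⟨ cong 𝟙 (cong₂ _∧_ (cong (_≡ᵇ e) (deg-· 0 u v)) (monEq-congˡ m (drop-· u v))) ⟨
  𝟙 ((deg 0 (u · v) ≡ᵇ e) ∧ monEq (drop 1 (u · v)) m)
    ≡⟨ cong 𝟙 (monEq-∷ (u · v) e m) ⟨
  𝟙 (monEq (u · v) (e ∷ m))
    ∎
  where
  open ≡-Reasoning
  heads : ℕ → ℕ
  heads i = 𝟙 (deg 0 u ≡ᵇ i) * 𝟙 (deg 0 v ≡ᵇ (e ∸ i))
  column : ∀ i → ∑ (λ p → 𝟙 (monEq u (i ∷ proj₁ p)) * 𝟙 (monEq v ((e ∸ i) ∷ proj₂ p))) (splits m)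
                 ≡ heads i * 𝟙 (monEq (drop 1 u · drop 1 v) m)
  column i = begin
    ∑ (λ p → 𝟙 (monEq u (i ∷ proj₁ p)) * 𝟙 (monEq v ((e ∸ i) ∷ proj₂ p))) (splits m)
      ≡⟨ ∑-cong (splits m) (λ p → trans (cong₂ _*_ (split-𝟙 u i (proj₁ p)) (split-𝟙 v (e ∸ i) (proj₂ p)))
                                         (*-interchange (𝟙 (deg 0 u ≡ᵇ i)) _ _ _)) ⟩
    ∑ (λ p → heads i * (𝟙 (monEq (drop 1 u) (proj₁ p)) * 𝟙 (monEq (drop 1 v) (proj₂ p)))) (splits m)
      ≡⟨ ∑-*ˡ (heads i) _ (splits m) ⟩
    heads i * ∑ (λ p → 𝟙 (monEq (drop 1 u) (proj₁ p)) * 𝟙 (monEq (drop 1 v) (proj₂ p))) (splits m)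
      ≡⟨ cong (heads i *_) (∑-splits-monEq m (drop 1 u) (drop 1 v)) ⟩
    heads i * 𝟙 (monEq (drop 1 u · drop 1 v) m)
      ∎
    where
    split-𝟙 : ∀ w c d → 𝟙 (monEq w (c ∷ d)) ≡ 𝟙 (deg 0 w ≡ᵇ c) * 𝟙 (monEq (drop 1 w) d)
    split-𝟙 w c d = trans (cong 𝟙 (monEq-∷ w c d)) (𝟙-∧ (deg 0 w ≡ᵇ c) _)

countSeries : (ℕ → List A) → (A → Mon) → Seriesᴺ
countSeries C w m = count (λ x → monEq (w x) m) (C (deg 0 m))

Graded : (ℕ → List A) → (A → Mon) → Set
Graded C w = ∀ i → All (λ x → deg 0 (w x) ≡ i) (C i)

monEq-∷-deg₀ : ∀ u {e} v → deg 0 u ≡ e → monEq u (e ∷ v) ≡ monEq (drop 1 u) v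
monEq-∷-deg₀ u {e} v u≡e = trans (monEq-∷ u e v) (cong (_∧ monEq (drop 1 u) v) (trans (cong (_≡ᵇ e) u≡e) (≡ᵇ-refl e)))

∑-splits-monEq-∷ : ∀ m {e i} u v → deg 0 u ≡ i → deg 0 v ≡ e ∸ i → i ≤ e →
  ∑ (λ p → 𝟙 (monEq u (i ∷ proj₁ p)) * 𝟙 (monEq v ((e ∸ i) ∷ proj₂ p))) (splits m) ≡ 𝟙 (monEq (u · v) (e ∷ m))
∑-splits-monEq-∷ m {e} {i} u v u≡i v≡e∸i i≤e = begin
  ∑ (λ p → 𝟙 (monEq u (i ∷ proj₁ p)) * 𝟙 (monEq v ((e ∸ i) ∷ proj₂ p))) (splits m)
    ≡⟨ ∑-cong (splits m) (λ p → cong₂ _*_ (cong 𝟙 (monEq-∷-deg₀ u (proj₁ p) u≡i))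
                                          (cong 𝟙 (monEq-∷-deg₀ v (proj₂ p) v≡e∸i))) ⟩
  ∑ (λ p → 𝟙 (monEq (drop 1 u) (proj₁ p)) * 𝟙 (monEq (drop 1 v) (proj₂ p))) (splits m)
    ≡⟨ ∑-splits-monEq m (drop 1 u) (drop 1 v) ⟩
  𝟙 (monEq (drop 1 u · drop 1 v) m)
    ≡⟨ cong 𝟙 (monEq-congˡ m (drop-· u v)) ⟨
  𝟙 (monEq (drop 1 (u · v)) m)
    ≡⟨ cong 𝟙 (monEq-∷-deg₀ (u · v) m uv≡e) ⟨
  𝟙 (monEq (u · v) (e ∷ m))
    ∎
  where
  open ≡-Reasoning
  uv≡e : deg 0 (u · v) ≡ e
  uv≡e = trans (deg-· 0 u v) (trans (cong₂ _+_ u≡i v≡e∸i) (m+[n∸m]≡n i≤e))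

countSeries-*ᴺ : ∀ (CA : ℕ → List A) (CB : ℕ → List B) (wA : A → Mon) (wB : B → Mon) →
  Graded CA wA → Graded CB wB → ∀ m →
  (countSeries CA wA *ᴺ countSeries CB wB) m ≡
  ∑ (λ i → ∑ (λ x → count (λ y → monEq (wA x · wB y) m) (CB (deg 0 m ∸ i))) (CA i)) (upTo (suc (deg 0 m)))
countSeries-*ᴺ CA CB wA wB _ _ [] = begin
  count (λ x → monEq (wA x) []) (CA 0) * count (λ y → monEq (wB y) []) (CB 0) + 0
    ≡⟨ +-identityʳ _ ⟩
  count (λ x → monEq (wA x) []) (CA 0) * count (λ y → monEq (wB y) []) (CB 0)
    ≡⟨ count-* (λ x → monEq (wA x) []) (λ y → monEq (wB y) []) (CA 0) (CB 0) ⟩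
  ∑ (λ x → ∑ (λ y → 𝟙 (monEq (wA x) []) * 𝟙 (monEq (wB y) [])) (CB 0)) (CA 0)
    ≡⟨ ∑-cong (CA 0) (λ x → ∑-cong (CB 0) (λ y → 𝟙-monEq-[] (wA x) (wB y))) ⟩
  ∑ (λ x → count (λ y → monEq (wA x · wB y) []) (CB 0)) (CA 0)
    ≡⟨ +-identityʳ _ ⟨
  ∑ (λ x → count (λ y → monEq (wA x · wB y) []) (CB 0)) (CA 0) + 0
    ∎
  where open ≡-Reasoning
countSeries-*ᴺ CA CB wA wB gradedA gradedB (e ∷ m) =
  trans (∑-splits-∷ _ e m) (∑-upTo-cong (suc e) column)
  where
  open ≡-Reasoning
  column : ∀ {i} → i < suc e →
    ∑ (λ p → countSeries CA wA (i ∷ proj₁ p) * countSeries CB wB ((e ∸ i) ∷ proj₂ p)) (splits m)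
    ≡ ∑ (λ x → count (λ y → monEq (wA x · wB y) (e ∷ m)) (CB (e ∸ i))) (CA i)
  column {i} i<1+e = begin
    ∑ (λ p → countSeries CA wA (i ∷ proj₁ p) * countSeries CB wB ((e ∸ i) ∷ proj₂ p)) (splits m)
      ≡⟨ ∑-cong (splits m) (λ p → count-* _ _ (CA i) (CB (e ∸ i))) ⟩
    ∑ (λ p → ∑ (λ x → ∑ (λ y → term p x y) (CB (e ∸ i))) (CA i)) (splits m)
      ≡⟨ ∑-comm (λ p x → ∑ (term p x) (CB (e ∸ i))) (splits m) (CA i) ⟩
    ∑ (λ x → ∑ (λ p → ∑ (λ y → term p x y) (CB (e ∸ i))) (splits m)) (CA i)
      ≡⟨ ∑-cong-All (All.map (λ {x} deg-x → trans (∑-comm (λ p y → term p x y) (splits m) (CB (e ∸ i)))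
           (∑-cong-All (All.map (λ {y} deg-y → ∑-splits-monEq-∷ m (wA x) (wB y) deg-x deg-y (≤-pred i<1+e))
                                (gradedB (e ∸ i)))))
                        (gradedA i)) ⟩
    ∑ (λ x → count (λ y → monEq (wA x · wB y) (e ∷ m)) (CB (e ∸ i))) (CA i)
      ∎
    where
    term : Mon × Mon → _ → _ → ℕ
    term p x y = 𝟙 (monEq (wA x) (i ∷ proj₁ p)) * 𝟙 (monEq (wB y) ((e ∸ i) ∷ proj₂ p))

atDegree : ℕ → ℕ → List ⊤
atDegree c i = if c ≡ᵇ i then tt ∷ [] else []

monoᴺ≗countSeries : ∀ e d → monoᴺ e d ≡ countSeries (atDegree (deg 0 e)) (λ _ → e) d
monoᴺ≗countSeries e d with deg 0 e ≡ᵇ deg 0 d in same-deg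
... | true  = sym (+-identityʳ _)
... | false with monEq e d in e≡d
...   | false = refl
...   | true  with () ← trans (sym same-deg) (trans (cong (deg 0 e ≡ᵇ_) (sym (monEq⇒deg₀≡ e d e≡d))) (≡ᵇ-refl (deg 0 e)))

monoᴺ-*ᴺ-countSeries : ∀ e {c} (CB : ℕ → List B) (wB : B → Mon) → Graded CB wB →
  deg 0 e ≡ c → ∀ m → c ≤ deg 0 m →
  (monoᴺ e *ᴺ countSeries CB wB) m ≡ count (λ y → monEq (e · wB y) m) (CB (deg 0 m ∸ c))
monoᴺ-*ᴺ-countSeries e {c} CB wB gradedB refl m c≤m = begin
  (monoᴺ e *ᴺ countSeries CB wB) m
    ≡⟨ *ᴺ-cong (monoᴺ≗countSeries e) (λ _ → refl) m ⟩
  (countSeries (atDegree c) (λ _ → e) *ᴺ countSeries CB wB) m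
    ≡⟨ countSeries-*ᴺ (atDegree c) CB (λ _ → e) wB graded-e gradedB m ⟩
  ∑ (λ i → column i) (upTo (suc (deg 0 m)))
    ≡⟨ ∑-upTo-δ column (suc (deg 0 m)) off (s≤s c≤m) ⟩
  column c
    ≡⟨ cong (λ b → ∑ (λ _ → count (λ y → monEq (e · wB y) m) (CB (deg 0 m ∸ c))) (if b then tt ∷ [] else [])) (≡ᵇ-refl c) ⟩
  count (λ y → monEq (e · wB y) m) (CB (deg 0 m ∸ c)) + 0
    ≡⟨ +-identityʳ _ ⟩
  count (λ y → monEq (e · wB y) m) (CB (deg 0 m ∸ c))
    ∎
  where
  open ≡-Reasoning
  column : ℕ → ℕ
  column i = ∑ (λ _ → count (λ y → monEq (e · wB y) m) (CB (deg 0 m ∸ i))) (atDegree c i)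
  graded-e : Graded (atDegree c) (λ _ → e)
  graded-e i with c ≡ᵇ i in c≡i
  ... | true  = ≡ᵇ⇒≡′ c≡i ∷ []
  ... | false = []
  off : ∀ {i} → i < suc (deg 0 m) → i ≢ c → column i ≡ 0
  off {i} _ i≢c rewrite ≢⇒≡ᵇ-false (i≢c ∘ sym) = refl

NoConstantTerm : Seriesᴺ → Set
NoConstantTerm g = ∀ d → totDeg d ≡ 0 → g d ≡ 0

IsSplit-totDeg< : ∀ {m d d′} → IsSplit m (d , d′) → totDeg d ≢ 0 → totDeg d′ < totDeg m
IsSplit-totDeg< {m} {d} {d′} (mkSplit _ tot) d≢0 = begin-strict
  totDeg d′             <⟨ m<n+m (totDeg d′) (n≢0⇒n>0 d≢0) ⟩
  totDeg d + totDeg d′  ≡⟨ tot ⟩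
  totDeg m              ∎
  where open ≤-Reasoning

^ᴺ-vanish : ∀ g → NoConstantTerm g → ∀ k m → totDeg m < k → (g ^ᴺ k) m ≡ 0
^ᴺ-vanish g g₀≡0 (suc k) m m<1+k = *ᴺ-zero-split {g} {g ^ᴺ k} m vanish
  where
  vanish : ∀ d d′ → IsSplit m (d , d′) → g d * (g ^ᴺ k) d′ ≡ 0
  vanish d d′ split with totDeg d ≟ 0
  ... | yes d≡0 rewrite g₀≡0 d d≡0 = refl
  ... | no  d≢0 = trans (cong (g d *_) (^ᴺ-vanish g g₀≡0 k d′ (<-≤-trans (IsSplit-totDeg< split d≢0) (≤-pred m<1+k))))
                        (*-zeroʳ (g d))

invOneMinusᴺ-fix : ∀ g → NoConstantTerm g → ∀ m → invOneMinusᴺ g m ≡ oneᴺ m + (g *ᴺ invOneMinusᴺ g) m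
invOneMinusᴺ-fix g g₀≡0 m = begin
  invOneMinusᴺ g m
    ≡⟨ ∑-upTo-sucˡ (λ k → (g ^ᴺ k) m) D ⟩
  oneᴺ m + ∑ (λ k → (g ^ᴺ suc k) m) (upTo D)
    ≡⟨ cong (oneᴺ m +_) (∑-upTo-extend (λ k → (g ^ᴺ suc k) m) (suc D) (n≤1+n D)
                           (λ {k} D≤k _ → ^ᴺ-vanish g g₀≡0 (suc k) m (s≤s D≤k))) ⟨
  oneᴺ m + ∑ (λ k → (g *ᴺ g ^ᴺ k) m) (upTo (suc D))
    ≡⟨ cong (oneᴺ m +_) (∑-comm (λ k p → g (proj₁ p) * (g ^ᴺ k) (proj₂ p)) (upTo (suc D)) (splits m)) ⟩
  oneᴺ m + ∑ (λ p → ∑ (λ k → g (proj₁ p) * (g ^ᴺ k) (proj₂ p)) (upTo (suc D))) (splits m)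
    ≡⟨ cong (oneᴺ m +_) (∑-cong-All (All.map (λ {p} → factor (proj₁ p) (proj₂ p)) (splits-IsSplit m))) ⟩
  oneᴺ m + (g *ᴺ invOneMinusᴺ g) m
    ∎
  where
  open ≡-Reasoning
  D : ℕ
  D = totDeg m
  factor : ∀ d d′ → IsSplit m (d , d′) → ∑ (λ k → g d * (g ^ᴺ k) d′) (upTo (suc D)) ≡ g d * invOneMinusᴺ g d′
  factor d d′ split with totDeg d ≟ 0
  ... | yes d≡0 rewrite g₀≡0 d d≡0 = ∑-zero (upTo (suc D))
  ... | no  d≢0 = trans (∑-*ˡ (g d) (λ k → (g ^ᴺ k) d′) (upTo (suc D))) (cong (g d *_)
    (∑-upTo-extend (λ k → (g ^ᴺ k) d′) (suc D) (<⇒≤ (s≤s (IsSplit-totDeg< split d≢0)))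
                   (λ d′<k _ → ^ᴺ-vanish g g₀≡0 _ d′ d′<k)))

-- The coefficient of g · X at m only involves X at lower total degree.
invOneMinusᴺ-unique : ∀ g X → NoConstantTerm g → (∀ m → X m ≡ oneᴺ m + (g *ᴺ X) m) → ∀ m → X m ≡ invOneMinusᴺ g m
invOneMinusᴺ-unique g X g₀≡0 X-fix m = below (suc (totDeg m)) m ≤-refl
  where
  below : ∀ B m → totDeg m < B → X m ≡ invOneMinusᴺ g m
  below (suc B) m m<1+B = begin
    X m                                  ≡⟨ X-fix m ⟩
    oneᴺ m + (g *ᴺ X) m                  ≡⟨ cong (oneᴺ m +_) (*ᴺ-cong-split {g} {X} {g} {invOneMinusᴺ g} m step) ⟩
    oneᴺ m + (g *ᴺ invOneMinusᴺ g) m     ≡⟨ invOneMinusᴺ-fix g g₀≡0 m ⟨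
    invOneMinusᴺ g m                     ∎
    where
    open ≡-Reasoning
    step : ∀ d d′ → IsSplit m (d , d′) → g d * X d′ ≡ g d * invOneMinusᴺ g d′
    step d d′ split with totDeg d ≟ 0
    ... | yes d≡0 rewrite g₀≡0 d d≡0 = refl
    ... | no  d≢0 = cong (g d *_) (below B d′ (<-≤-trans (IsSplit-totDeg< split d≢0) (≤-pred m<1+B)))

AgreeUpTo : ℕ → Seriesᴺ → Seriesᴺ → Set
AgreeUpTo n f g = ∀ m → deg 0 m ≤ n → f m ≡ g m

agree-weaken : ∀ {n n′ f g} → n′ ≤ n → AgreeUpTo n f g → AgreeUpTo n′ f g
agree-weaken n′≤n f≈g m m≤n′ = f≈g m (≤-trans m≤n′ n′≤n)

agree-+ᴺ : ∀ {n f₁ f₂ g₁ g₂} → AgreeUpTo n f₁ f₂ → AgreeUpTo n g₁ g₂ → AgreeUpTo n (f₁ +ᴺ g₁) (f₂ +ᴺ g₂)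
agree-+ᴺ f≈ g≈ m m≤n = cong₂ _+_ (f≈ m m≤n) (g≈ m m≤n)

agree-*ᴺ : ∀ {n f₁ f₂ g₁ g₂} → AgreeUpTo n f₁ f₂ → AgreeUpTo n g₁ g₂ → AgreeUpTo n (f₁ *ᴺ g₁) (f₂ *ᴺ g₂)
agree-*ᴺ {n} {f₁} {f₂} {g₁} {g₂} f≈ g≈ m m≤n = *ᴺ-cong-split {f₁} {g₁} {f₂} {g₂} m step
  where
  step : ∀ d d′ → IsSplit m (d , d′) → f₁ d * g₁ d′ ≡ f₂ d * g₂ d′
  step d d′ (mkSplit deg₀ _) = cong₂ _*_ (f≈ d (≤-trans (m≤m+n _ _) sum≤n)) (g≈ d′ (≤-trans (m≤n+m _ _) sum≤n))
    where
    sum≤n : deg 0 d + deg 0 d′ ≤ n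
    sum≤n = subst (_≤ n) (sym deg₀) m≤n

agree-^ᴺ : ∀ {n f g} → AgreeUpTo n f g → ∀ k → AgreeUpTo n (f ^ᴺ k) (g ^ᴺ k)
agree-^ᴺ f≈g zero    m m≤n = refl
agree-^ᴺ f≈g (suc k) = agree-*ᴺ f≈g (agree-^ᴺ f≈g k)

agree-invOneMinusᴺ : ∀ {n f g} → AgreeUpTo n f g → AgreeUpTo n (invOneMinusᴺ f) (invOneMinusᴺ g)
agree-invOneMinusᴺ f≈g m m≤n = ∑-cong (upTo (suc (totDeg m))) (λ k → agree-^ᴺ f≈g k m m≤n)

agree-monoᴺ-*ᴺ : ∀ {n f g} b → deg 0 b ≡ 2 → AgreeUpTo n f g → AgreeUpTo (2 + n) (monoᴺ b *ᴺ f) (monoᴺ b *ᴺ g)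
agree-monoᴺ-*ᴺ {n} {f} {g} b b≡2 f≈g m m≤2+n = *ᴺ-cong-split {monoᴺ b} {f} {monoᴺ b} {g} m step
  where
  step : ∀ d d′ → IsSplit m (d , d′) → monoᴺ b d * f d′ ≡ monoᴺ b d * g d′
  step d d′ (mkSplit deg₀ _) with monEq b d in b≡d
  ... | false = refl
  ... | true  = cong (1 *_) (f≈g d′ (+-cancelˡ-≤ 2 _ _ (subst (_≤ 2 + n) (sym deg-sum) m≤2+n)))
    where
    deg-sum : 2 + deg 0 d′ ≡ deg 0 m
    deg-sum = trans (cong (_+ deg 0 d′) (trans (sym b≡2) (monEq⇒deg₀≡ b d b≡d))) deg₀

cfTailᴺ : ℕ → ℕ → Seriesᴺ
cfTailᴺ zero    k = monoᴺ (aMon k)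
cfTailᴺ (suc d) k = monoᴺ (aMon k) +ᴺ monoᴺ (bMon k) *ᴺ invOneMinusᴺ (cfTailᴺ d (suc k))

module Convergents (F : ℕ → Seriesᴺ)
  (F-unfold : ∀ k m → F k m ≡ invOneMinusᴺ (monoᴺ (aMon (suc k)) +ᴺ monoᴺ (bMon (suc k)) *ᴺ F (suc k)) m) where

  tailAgrees : ∀ d k → AgreeUpTo (suc (d + d)) (cfTailᴺ d (suc k)) (monoᴺ (aMon (suc k)) +ᴺ monoᴺ (bMon (suc k)) *ᴺ F (suc k))
  tailAgrees zero    k m m≤1 = sym (trans (cong (monoᴺ (aMon (suc k)) m +_)
    (monoᴺ-*ᴺ-below (bMon (suc k)) (F (suc k)) m (subst (deg 0 m <_) (sym (deg₀-bMon k)) (s≤s m≤1)))) (+-identityʳ _))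
  tailAgrees (suc d) k = agree-+ᴺ {f₁ = monoᴺ (aMon (suc k))} (λ _ _ → refl)
    (agree-weaken (s≤s (s≤s (≤-reflexive (+-suc d d))))
      (agree-monoᴺ-*ᴺ (bMon (suc k)) (deg₀-bMon k)
        (λ m m≤ → trans (agree-invOneMinusᴺ (tailAgrees d (suc k)) m m≤) (sym (F-unfold (suc k) m)))))

  convergent-agrees : ∀ N → AgreeUpTo (suc (N + N)) (invOneMinusᴺ (cfTailᴺ N 1)) (F 0)
  convergent-agrees N m m≤ = trans (agree-invOneMinusᴺ (tailAgrees N 0) m m≤) (sym (F-unfold 0 m))

countB-++ : ∀ p xs ys → countB p (xs ++ ys) ≡ countB p xs + countB p ys
countB-++ p []       ys = refl
countB-++ p (x ∷ xs) ys = trans (cong (𝟙 (p x) +_) (countB-++ p xs ys)) (sym (+-assoc (𝟙 (p x)) _ _))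

countB-map : ∀ p f xs → countB p (map f xs) ≡ countB (p ∘ f) xs
countB-map p f []       = refl
countB-map p f (x ∷ xs) = cong (𝟙 (p (f x)) +_) (countB-map p f xs)

countB-cong : ∀ {p q} xs → (∀ x → p x ≡ q x) → countB p xs ≡ countB q xs
countB-cong []       p≗q = refl
countB-cong (x ∷ xs) p≗q = cong₂ _+_ (cong 𝟙 (p≗q x)) (countB-cong xs p≗q)

countB-false : ∀ xs → countB (λ _ → false) xs ≡ 0
countB-false []       = refl
countB-false (_ ∷ xs) = countB-false xs

incAbove : ℕ → ℕ → List ℕ → ℕ
incAbove zero    b xs       = 1
incAbove (suc j) b []       = 0
incAbove (suc j) b (x ∷ xs) = (if b <ᵇ x then incAbove j x xs else 0) + incAbove (suc j) b xs

inc : ℕ → List ℕ → ℕ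
inc zero    xs       = 1
inc (suc j) []       = 0
inc (suc j) (x ∷ xs) = incAbove j x xs + inc (suc j) xs

private
  countB-increasing-∷ : ∀ xs x j → countB (λ s → (length s ≡ᵇ j) ∧ increasing (x ∷ s)) (sublists xs) ≡ incAbove j x xs
  countB-increasing-∷ []       x zero    = refl
  countB-increasing-∷ []       x (suc j) = refl
  countB-increasing-∷ (y ∷ ys) x j = trans (countB-++ _ (map (y ∷_) (sublists ys)) (sublists ys))
    (trans (cong₂ _+_ (countB-map (λ s → (length s ≡ᵇ j) ∧ increasing (x ∷ s)) (y ∷_) (sublists ys))
                      (countB-increasing-∷ ys x j))
           (with-y j))
    where
    with-y : ∀ j → countB (λ s → (suc (length s) ≡ᵇ j) ∧ ((x <ᵇ y) ∧ increasing (y ∷ s))) (sublists ys) + incAbove j x ys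
                   ≡ incAbove j x (y ∷ ys)
    with-y zero = cong (_+ 1) (countB-false (sublists ys))
    with-y (suc j) with x <ᵇ y
    ... | true  = cong (_+ incAbove (suc j) x ys) (countB-increasing-∷ ys y j)
    ... | false = cong (_+ incAbove (suc j) x ys)
      (trans (countB-cong (sublists ys) (λ s → ∧-zeroʳ (length s ≡ᵇ j))) (countB-false (sublists ys)))

occInc≡inc : ∀ j xs → occInc j xs ≡ inc j xs
occInc≡inc zero    []       = refl
occInc≡inc (suc j) []       = refl
occInc≡inc j       (x ∷ xs) = trans (countB-++ _ (map (x ∷_) (sublists xs)) (sublists xs))
  (trans (cong₂ _+_ (countB-map (λ s → (length s ≡ᵇ j) ∧ increasing s) (x ∷_) (sublists xs)) (occInc≡inc j xs))
         (with-x j))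
  where
  with-x : ∀ j → countB (λ s → (suc (length s) ≡ᵇ j) ∧ increasing (x ∷ s)) (sublists xs) + inc j xs ≡ inc j (x ∷ xs)
  with-x zero    = cong (_+ 1) (countB-false (sublists xs))
  with-x (suc j) = cong (_+ inc (suc j) xs) (countB-increasing-∷ xs x j)

incAbove-long : ∀ j b xs → length xs < j → incAbove j b xs ≡ 0
incAbove-long (suc j) b []       _           = refl
incAbove-long (suc j) b (x ∷ xs) (s≤s xs<j) =
  cong₂ _+_ (first (b <ᵇ x)) (incAbove-long (suc j) b xs (m<n⇒m<1+n xs<j))
  where
  first : ∀ c → (if c then incAbove j x xs else 0) ≡ 0
  first true  = incAbove-long j x xs xs<j
  first false = refl

inc-long : ∀ j xs → length xs < j → inc j xs ≡ 0
inc-long (suc j) []       _           = refl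
inc-long (suc j) (x ∷ xs) (s≤s xs<j) = cong₂ _+_ (incAbove-long j x xs xs<j) (inc-long (suc j) xs (m<n⇒m<1+n xs<j))

inc-1 : ∀ xs → inc 1 xs ≡ length xs
inc-1 []       = refl
inc-1 (x ∷ xs) = cong suc (inc-1 xs)

deg-monOf : ∀ t π → deg t (monOf π) ≡ inc (suc t) π
deg-monOf t π = trans (deg-upTo (λ j → occInc (suc j) π) (length π) t
  (λ {t} π<1+t → trans (occInc≡inc (suc t) π) (inc-long (suc t) π (s≤s π<1+t)))) (occInc≡inc (suc t) π)

deg₀-monOf : ∀ π → deg 0 (monOf π) ≡ length π
deg₀-monOf π = trans (deg-monOf 0 π) (inc-1 π)

incAbove-none : ∀ j b ys → All (_≤ b) ys → incAbove (suc j) b ys ≡ 0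
incAbove-none j b []       _          = refl
incAbove-none j b (y ∷ ys) (y≤b ∷ ys≤b) rewrite ≥⇒<ᵇ-false {b} {y} y≤b = incAbove-none j b ys ys≤b

incAbove-max : ∀ N ys → All (_< N) ys → ∀ t → incAbove t N ys ≡ deg t x₁
incAbove-max N ys ys<N zero    = refl
incAbove-max N ys ys<N (suc t) = incAbove-none t N ys (All.map <⇒≤ ys<N)

incAbove-++-below : ∀ c xs ys → All (c ≤_) xs → All (_< c) ys → ∀ j b → c ≤ b → incAbove j b (xs ++ ys) ≡ incAbove j b xs
incAbove-++-below c xs       ys xs≥c ys<c zero    b c≤b = refl
incAbove-++-below c []       ys _    ys<c (suc j) b c≤b = incAbove-none j b ys (All.map (λ y<c → ≤-trans (<⇒≤ y<c) c≤b) ys<c)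
incAbove-++-below c (x ∷ xs) ys (c≤x ∷ xs≥c) ys<c (suc j) b c≤b =
  cong₂ _+_ (cong (if b <ᵇ x then_else 0) (incAbove-++-below c xs ys xs≥c ys<c j x c≤x))
            (incAbove-++-below c xs ys xs≥c ys<c (suc j) b c≤b)

inc-++-below : ∀ c xs ys → All (c ≤_) xs → All (_< c) ys → ∀ j → inc (suc j) (xs ++ ys) ≡ inc (suc j) xs + inc (suc j) ys
inc-++-below c []       ys _            ys<c j = refl
inc-++-below c (x ∷ xs) ys (c≤x ∷ xs≥c) ys<c j =
  trans (cong₂ _+_ (incAbove-++-below c xs ys xs≥c ys<c j x c≤x) (inc-++-below c xs ys xs≥c ys<c j))
        (sym (+-assoc (incAbove j x xs) _ _))

incAbove-+ʳ : ∀ u j b xs → incAbove j (b + u) (map (_+ u) xs) ≡ incAbove j b xs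
incAbove-+ʳ u zero    b xs       = refl
incAbove-+ʳ u (suc j) b []       = refl
incAbove-+ʳ u (suc j) b (x ∷ xs) rewrite <ᵇ-+ʳ b x u =
  cong₂ _+_ (cong (if b <ᵇ x then_else 0) (incAbove-+ʳ u j x xs)) (incAbove-+ʳ u (suc j) b xs)

inc-+ʳ : ∀ u j xs → inc j (map (_+ u) xs) ≡ inc j xs
inc-+ʳ u zero    xs       = refl
inc-+ʳ u (suc j) []       = refl
inc-+ʳ u (suc j) (x ∷ xs) = cong₂ _+_ (incAbove-+ʳ u j x xs) (inc-+ʳ u (suc j) xs)

-- The new occurrences are those ending at N.
incAbove-++-uN : ∀ u N xs → All (λ x → u < x × x < N) xs → ∀ j b → u ≤ b → b < N →
                 incAbove (suc j) b (xs ++ u ∷ N ∷ []) ≡ incAbove (suc j) b xs + incAbove j b xs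
incAbove-++-uN u N [] _ zero    b u≤b b<N rewrite ≥⇒<ᵇ-false {b} {u} u≤b | <⇒<ᵇ′ b<N = refl
incAbove-++-uN u N [] _ (suc j) b u≤b b<N rewrite ≥⇒<ᵇ-false {b} {u} u≤b | <⇒<ᵇ′ b<N = refl
incAbove-++-uN u N (x ∷ xs) ((u<x , x<N) ∷ xs∈) zero b u≤b b<N
  rewrite incAbove-++-uN u N xs xs∈ zero b u≤b b<N = sym (+-assoc (if b <ᵇ x then 1 else 0) (incAbove 1 b xs) 1)
incAbove-++-uN u N (x ∷ xs) ((u<x , x<N) ∷ xs∈) (suc j) b u≤b b<N
  rewrite incAbove-++-uN u N xs xs∈ (suc j) b u≤b b<N | incAbove-++-uN u N xs xs∈ j x (<⇒≤ u<x) x<N with b <ᵇ x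
... | true  = +-interchange (incAbove (suc j) x xs) (incAbove j x xs) _ _
... | false = refl

incBefore : ℕ → List ℕ → ℕ
incBefore zero    _  = 0
incBefore (suc t) xs = inc (suc t) xs

inc-++-uN : ∀ u N xs → u < N → All (λ x → u < x × x < N) xs → ∀ t →
            inc (suc t) (xs ++ u ∷ N ∷ []) ≡ (inc (suc t) xs + incBefore t xs) + deg t x₁²x₂
inc-++-uN u N [] u<N _ zero                = refl
inc-++-uN u N [] u<N _ (suc zero)    rewrite <⇒<ᵇ′ u<N = refl
inc-++-uN u N [] u<N _ (suc (suc t)) rewrite <⇒<ᵇ′ u<N = refl
inc-++-uN u N (x ∷ xs) u<N ((u<x , x<N) ∷ xs∈) zero rewrite inc-++-uN u N xs u<N xs∈ zero = refl
inc-++-uN u N (x ∷ xs) u<N ((u<x , x<N) ∷ xs∈) (suc t)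
  rewrite inc-++-uN u N xs u<N xs∈ (suc t) | incAbove-++-uN u N xs xs∈ t x (<⇒≤ u<x) x<N = begin
  (a + c) + ((d + e) + f)   ≡⟨ +-assoc (a + c) (d + e) f ⟨
  ((a + c) + (d + e)) + f   ≡⟨ cong (_+ f) (+-interchange a c d e) ⟩
  ((a + d) + (c + e)) + f   ∎
  where
  open ≡-Reasoning
  a = incAbove (suc t) x xs
  c = incAbove t x xs
  d = inc (suc (suc t)) xs
  e = inc (suc t) xs
  f = deg (suc t) x₁²x₂

has132Above : ℕ → List ℕ → Bool
has132Above x []       = false
has132Above x (b ∷ ys) = any (λ c → (x <ᵇ c) ∧ (c <ᵇ b)) ys ∨ has132Above x ys

has132 : List ℕ → Bool
has132 []       = false
has132 (x ∷ xs) = has132Above x xs ∨ has132 xs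

private
  any-132-∷∷∷ : ∀ x b c zs → any (λ s → is132 (x ∷ b ∷ c ∷ s)) (sublists zs) ≡ (x <ᵇ c) ∧ (c <ᵇ b)
  any-132-∷∷∷ x b c []       = ∨-identityʳ _
  any-132-∷∷∷ x b c (d ∷ ws) = trans (any-++ _ (map (d ∷_) (sublists ws)) (sublists ws))
    (trans (cong (_∨ _) (trans (any-map (λ s → is132 (x ∷ b ∷ c ∷ s)) (d ∷_) (sublists ws))
                               (any-false (λ _ → false) (sublists ws) (λ _ → refl))))
           (any-132-∷∷∷ x b c ws))

  any-132-∷∷ : ∀ x b ys → any (λ s → is132 (x ∷ b ∷ s)) (sublists ys) ≡ any (λ c → (x <ᵇ c) ∧ (c <ᵇ b)) ys
  any-132-∷∷ x b []       = refl
  any-132-∷∷ x b (c ∷ zs) = trans (any-++ _ (map (c ∷_) (sublists zs)) (sublists zs))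
    (cong₂ _∨_ (trans (any-map (λ s → is132 (x ∷ b ∷ s)) (c ∷_) (sublists zs)) (any-132-∷∷∷ x b c zs))
               (any-132-∷∷ x b zs))

  any-132-∷ : ∀ x xs → any (λ s → is132 (x ∷ s)) (sublists xs) ≡ has132Above x xs
  any-132-∷ x []       = refl
  any-132-∷ x (b ∷ ys) = trans (any-++ _ (map (b ∷_) (sublists ys)) (sublists ys))
    (cong₂ _∨_ (trans (any-map (λ s → is132 (x ∷ s)) (b ∷_) (sublists ys)) (any-132-∷∷ x b ys)) (any-132-∷ x ys))

avoids132≡not-has132 : ∀ xs → avoids132 xs ≡ not (has132 xs)
avoids132≡not-has132 xs = cong not (any-132 xs)
  where
  any-132 : ∀ xs → any is132 (sublists xs) ≡ has132 xs
  any-132 []       = refl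
  any-132 (x ∷ xs) = trans (any-++ is132 (map (x ∷_) (sublists xs)) (sublists xs))
    (cong₂ _∨_ (trans (any-map is132 (x ∷_) (sublists xs)) (any-132-∷ x xs)) (any-132 xs))

has132Above-suffix : ∀ x xs ys → has132Above x ys ≡ true → has132Above x (xs ++ ys) ≡ true
has132Above-suffix x []       ys e = e
has132Above-suffix x (b ∷ xs) ys e = ∨-trueʳ _ (has132Above-suffix x xs ys e)

has132Above-prefix : ∀ x xs ys → has132Above x xs ≡ true → has132Above x (xs ++ ys) ≡ true
has132Above-prefix x (b ∷ xs) ys = ∨-mono
  (λ e → trans (any-++ (λ c → (x <ᵇ c) ∧ (c <ᵇ b)) xs ys) (∨-trueˡ _ e))
  (has132Above-prefix x xs ys)

has132-suffix : ∀ xs ys → has132 ys ≡ true → has132 (xs ++ ys) ≡ true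
has132-suffix []       ys e = e
has132-suffix (x ∷ xs) ys e = ∨-trueʳ _ (has132-suffix xs ys e)

has132-prefix : ∀ xs ys → has132 xs ≡ true → has132 (xs ++ ys) ≡ true
has132-prefix (x ∷ xs) ys = ∨-mono (has132Above-prefix x xs ys) (has132-prefix xs ys)

has132Above-below : ∀ x ys → All (_≤ x) ys → has132Above x ys ≡ false
has132Above-below x []       _            = refl
has132Above-below x (b ∷ ys) (_ ∷ ys≤x) =
  cong₂ _∨_ (any-false _ ys (λ {c} c∈ → cong (_∧ (c <ᵇ b)) (≥⇒<ᵇ-false (All.lookup ys≤x c∈)))) (has132Above-below x ys ys≤x)

has132Above-++ : ∀ x xs ys → (∀ {b c} → b ∈ xs → c ∈ ys → ((x <ᵇ c) ∧ (c <ᵇ b)) ≡ false) → has132Above x ys ≡ false →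
                 has132Above x (xs ++ ys) ≡ has132Above x xs
has132Above-++ x []       ys _     none = none
has132Above-++ x (b ∷ xs) ys cross none = cong₂ _∨_
  (trans (any-++ (λ c → (x <ᵇ c) ∧ (c <ᵇ b)) xs ys)
         (trans (cong (_ ∨_) (any-false _ ys (cross (here refl)))) (∨-identityʳ _)))
  (has132Above-++ x xs ys (cross ∘ there) none)

has132-++ : ∀ xs ys → (∀ {x b c} → x ∈ xs → b ∈ xs → c ∈ ys → ((x <ᵇ c) ∧ (c <ᵇ b)) ≡ false) →
            (∀ {x} → x ∈ xs → has132Above x ys ≡ false) → has132 (xs ++ ys) ≡ has132 xs ∨ has132 ys
has132-++ []       ys _     _    = refl
has132-++ (x ∷ xs) ys cross none = trans
  (cong₂ _∨_ (has132Above-++ x xs ys (cross (here refl) ∘ there) (none (here refl)))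
             (has132-++ xs ys (λ x∈ b∈ → cross (there x∈) (there b∈)) (none ∘ there)))
  (sym (∨-assoc (has132Above x xs) _ _))

has132-+ʳ : ∀ u xs → has132 (map (_+ u) xs) ≡ has132 xs
has132-+ʳ u []       = refl
has132-+ʳ u (x ∷ xs) = cong₂ _∨_ (above-+ʳ x xs) (has132-+ʳ u xs)
  where
  above-+ʳ : ∀ x ys → has132Above (x + u) (map (_+ u) ys) ≡ has132Above x ys
  above-+ʳ x []       = refl
  above-+ʳ x (b ∷ ys) = cong₂ _∨_
    (trans (any-map _ (_+ u) ys) (any-cong ys (λ c → cong₂ _∧_ (<ᵇ-+ʳ x c u) (<ᵇ-+ʳ c b u))))
    (above-+ʳ x ys)

has132-witness : ∀ α ρ {a c} N → a ∈ α → c ∈ ρ → a < c → c < N → has132 (α ++ N ∷ ρ) ≡ true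
has132-witness α ρ {a} {c} N a∈ c∈ a<c c<N with ∈-∃++ a∈
... | α₁ , α₂ , refl rewrite List.++-assoc α₁ (a ∷ α₂) (N ∷ ρ) =
  has132-suffix α₁ (a ∷ α₂ ++ N ∷ ρ) (∨-trueˡ _ (has132Above-suffix a α₂ (N ∷ ρ)
    (∨-trueˡ _ (any-true (λ c → (a <ᵇ c) ∧ (c <ᵇ N)) ρ c∈ a<c<N))))
  where
  a<c<N : ((a <ᵇ c) ∧ (c <ᵇ N)) ≡ true
  a<c<N rewrite <⇒<ᵇ′ a<c | <⇒<ᵇ′ c<N = refl

-- In bad1-23 pre xs, pre lists the entries already passed, most recent first.

any-reverseAcc : ∀ (p : ℕ → Bool) acc xs → any p (reverseAcc acc xs) ≡ any p xs ∨ any p acc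
any-reverseAcc p acc []       = refl
any-reverseAcc p acc (x ∷ xs) = trans (any-reverseAcc p (x ∷ acc) xs)
  (trans (sym (∨-assoc (any p xs) (p x) (any p acc))) (cong (_∨ any p acc) (∨-comm (any p xs) (p x))))

All-reverseAcc : ∀ {P : ℕ → Set} acc xs → All P acc → All P xs → All P (reverseAcc acc xs)
All-reverseAcc acc []       P-acc _           = P-acc
All-reverseAcc acc (x ∷ xs) P-acc (Px ∷ P-xs) = All-reverseAcc (x ∷ acc) xs (Px ∷ P-acc) P-xs

bad1-23-split : ∀ pre xs y ys → bad1-23 pre (xs ++ y ∷ ys) ≡ bad1-23 pre (xs ++ [ y ]) ∨ bad1-23 (reverseAcc pre xs) (y ∷ ys)
bad1-23-split pre []           y ys = refl
bad1-23-split pre (x ∷ [])     y ys = cong (_∨ bad1-23 (x ∷ pre) (y ∷ ys)) (sym (∨-identityʳ _))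
bad1-23-split pre (x ∷ x′ ∷ xs) y ys = trans (cong (_ ∨_) (bad1-23-split (x ∷ pre) (x′ ∷ xs) y ys))
  (sym (∨-assoc ((x <ᵇ x′) ∧ any (_<ᵇ x) pre) _ _))

bad1-23-∷ʳ-below : ∀ pre xs y → All (y <_) xs → bad1-23 pre (xs ++ [ y ]) ≡ bad1-23 pre xs
bad1-23-∷ʳ-below pre []           y _               = refl
bad1-23-∷ʳ-below pre (x ∷ [])     y (y<x ∷ [])      rewrite ≥⇒<ᵇ-false {x} {y} (<⇒≤ y<x) = refl
bad1-23-∷ʳ-below pre (x ∷ x′ ∷ xs) y (_ ∷ y<xs) = cong (_ ∨_) (bad1-23-∷ʳ-below (x ∷ pre) (x′ ∷ xs) y y<xs)

bad1-23-history-above : ∀ c pre → All (c ≤_) pre → ∀ ys q → All (_< c) ys → bad1-23 (q ++ pre) ys ≡ bad1-23 q ys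
bad1-23-history-above c pre pre≥c []           q _ = refl
bad1-23-history-above c pre pre≥c (u ∷ [])     q _ = refl
bad1-23-history-above c pre pre≥c (u ∷ v ∷ xs) q (u<c ∷ ys<c) = cong₂ _∨_
  (cong ((u <ᵇ v) ∧_) (trans (any-++ (_<ᵇ u) q pre)
    (trans (cong (_ ∨_) (any-false _ pre (λ p∈ → ≥⇒<ᵇ-false (≤-trans (<⇒≤ u<c) (All.lookup pre≥c p∈)))))
           (∨-identityʳ _))))
  (bad1-23-history-above c pre pre≥c (v ∷ xs) (u ∷ q) ys<c)

bad1-23-prefix : ∀ pre xs ys → bad1-23 pre xs ≡ true → bad1-23 pre (xs ++ ys) ≡ true
bad1-23-prefix pre (x ∷ x′ ∷ xs) ys = ∨-mono (λ e → e) (bad1-23-prefix (x ∷ pre) (x′ ∷ xs) ys)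

bad1-23-history-⊆ : ∀ q₁ q₂ ys → (∀ {z} → z ∈ q₁ → z ∈ q₂) → bad1-23 q₁ ys ≡ true → bad1-23 q₂ ys ≡ true
bad1-23-history-⊆ q₁ q₂ (u ∷ v ∷ xs) q₁⊆q₂ = ∨-mono
  (∧-monoʳ (u <ᵇ v) (any-⊆ (_<ᵇ u) q₁⊆q₂))
  (bad1-23-history-⊆ (u ∷ q₁) (u ∷ q₂) (v ∷ xs) (λ { (here eq) → here eq ; (there z∈) → there (q₁⊆q₂ z∈) }))

bad1-23-suffix : ∀ pre xs ys → bad1-23 [] ys ≡ true → bad1-23 pre (xs ++ ys) ≡ true
bad1-23-suffix pre xs (y ∷ ys) e rewrite bad1-23-split pre xs y ys =
  ∨-trueʳ _ (bad1-23-history-⊆ [] (reverseAcc pre xs) (y ∷ ys) (λ ()) e)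

bad1-23-witness : ∀ pre xs {a} u v zs → a ∈ xs → a < u → u < v → bad1-23 pre (xs ++ u ∷ v ∷ zs) ≡ true
bad1-23-witness pre xs u v zs a∈ a<u u<v
  rewrite bad1-23-split pre xs u (v ∷ zs) | <⇒<ᵇ′ u<v | any-reverseAcc (_<ᵇ u) pre xs
        | any-true (_<ᵇ u) xs a∈ (<⇒<ᵇ′ a<u) = ∨-trueʳ _ refl

bad1-23-+ʳ : ∀ u pre xs → bad1-23 (map (_+ u) pre) (map (_+ u) xs) ≡ bad1-23 pre xs
bad1-23-+ʳ u pre []           = refl
bad1-23-+ʳ u pre (x ∷ [])     = refl
bad1-23-+ʳ u pre (x ∷ x′ ∷ xs) = cong₂ _∨_
  (cong₂ _∧_ (<ᵇ-+ʳ x x′ u) (trans (any-map _ (_+ u) pre) (any-cong pre (λ z → <ᵇ-+ʳ z x u))))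
  (bad1-23-+ʳ u (x ∷ pre) (x′ ∷ xs))

bad1-23-max-∷ : ∀ N ρ Q → All (_≤ N) ρ → bad1-23 Q (N ∷ ρ) ≡ bad1-23 (N ∷ Q) ρ
bad1-23-max-∷ N []      Q _          = refl
bad1-23-max-∷ N (r ∷ ρ) Q (r≤N ∷ _) rewrite ≥⇒<ᵇ-false {N} {r} r≤N = refl

isMotzkin-intro : ∀ π → has132 π ≡ false → bad1-23 [] π ≡ false → isMotzkin π ≡ true
isMotzkin-intro π no132 no1-23 rewrite avoids132≡not-has132 π | no132 | no1-23 = refl

isMotzkin⇒no132 : ∀ π → isMotzkin π ≡ true → has132 π ≡ false
isMotzkin⇒no132 π e with has132 π in h | avoids132≡not-has132 π
... | false | _  = refl
... | true  | eq rewrite eq with () ← e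

isMotzkin⇒no1-23 : ∀ π → isMotzkin π ≡ true → bad1-23 [] π ≡ false
isMotzkin⇒no1-23 π e with bad1-23 [] π
... | false = refl
... | true  with () ← trans (sym (∧-zeroʳ (avoids132 π))) e

isMotzkin-suffix : ∀ xs ys → isMotzkin (xs ++ ys) ≡ true → isMotzkin ys ≡ true
isMotzkin-suffix xs ys mot = isMotzkin-intro ys
  (contraposeᵇ (has132-suffix xs ys) (isMotzkin⇒no132 (xs ++ ys) mot))
  (contraposeᵇ (bad1-23-suffix [] xs ys) (isMotzkin⇒no1-23 (xs ++ ys) mot))

isMotzkin-prefix : ∀ xs ys → isMotzkin (xs ++ ys) ≡ true → isMotzkin xs ≡ true
isMotzkin-prefix xs ys mot = isMotzkin-intro xs
  (contraposeᵇ (has132-prefix xs ys) (isMotzkin⇒no132 (xs ++ ys) mot))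
  (contraposeᵇ (bad1-23-prefix [] xs ys) (isMotzkin⇒no1-23 (xs ++ ys) mot))

isMotzkin-+ʳ : ∀ u σ → isMotzkin (map (_+ u) σ) ≡ true → isMotzkin σ ≡ true
isMotzkin-+ʳ u σ mot = isMotzkin-intro σ
  (trans (sym (has132-+ʳ u σ)) (isMotzkin⇒no132 (map (_+ u) σ) mot))
  (trans (sym (bad1-23-+ʳ u [] σ)) (isMotzkin⇒no1-23 (map (_+ u) σ) mot))

InRange : ℕ → List ℕ → Set
InRange n = All (λ x → 1 ≤ x × x ≤ n)

record IsPerm (n : ℕ) (π : List ℕ) : Set where
  constructor mkPerm
  field
    length≡ : length π ≡ n
    inRange : InRange n π
    unique  : Unique π

words-∈⁻ : ∀ l k {π} → π ∈ words l k → length π ≡ l × InRange k π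
words-∈⁻ zero    k (here refl) = refl , []
words-∈⁻ (suc l) k π∈ with find (∈-concatMap⁻ (λ i → map (suc i ∷_) (words l k)) {xs = upTo k} π∈)
... | i , i∈ , π∈i with ∈-map⁻ (suc i ∷_) π∈i
... | π′ , π′∈ , refl with words-∈⁻ l k π′∈
... | len , range = cong suc len , (s≤s z≤n , ∈-upTo⁻ i∈) ∷ range

words-∈⁺ : ∀ l k {π} → length π ≡ l → InRange k π → π ∈ words l k
words-∈⁺ zero    k {[]}        _   _                    = here refl
words-∈⁺ (suc l) k {suc i ∷ π} len ((_ , 1+i≤k) ∷ range) =
  ∈-concatMap⁺ (λ j → map (suc j ∷_) (words l k))
    (lose (∈-upTo⁺ 1+i≤k) (∈-map⁺ (suc i ∷_) (words-∈⁺ l k (suc-injective len) range)))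

words-unique : ∀ l k → Unique (words l k)
words-unique zero    k = [] ∷ []
words-unique (suc l) k = Unique-concatMap (λ i → map (suc i ∷_) (words l k)) firstLetter (Unique.upTo⁺ k)
  (λ i → Unique.map⁺ List.∷-injectiveʳ (words-unique l k)) firstLetter≡
  where
  firstLetter : List ℕ → ℕ
  firstLetter []      = 0
  firstLetter (x ∷ _) = x ∸ 1
  firstLetter≡ : ∀ {i π} → π ∈ map (suc i ∷_) (words l k) → firstLetter π ≡ i
  firstLetter≡ π∈ with ∈-map⁻ (suc _ ∷_) π∈
  ... | _ , _ , refl = refl

filterB-∈⁻ : ∀ p xs {x} → x ∈ filterB p xs → x ∈ xs × p x ≡ true
filterB-∈⁻ p (y ∷ xs) x∈ with p y in py
filterB-∈⁻ p (y ∷ xs) (here refl) | true = here refl , py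
filterB-∈⁻ p (y ∷ xs) (there x∈)  | true = let x∈xs , px = filterB-∈⁻ p xs x∈ in there x∈xs , px
filterB-∈⁻ p (y ∷ xs) x∈          | false = let x∈xs , px = filterB-∈⁻ p xs x∈ in there x∈xs , px

filterB-∈⁺ : ∀ p xs {x} → x ∈ xs → p x ≡ true → x ∈ filterB p xs
filterB-∈⁺ p (y ∷ xs) (here refl) px rewrite px = here refl
filterB-∈⁺ p (y ∷ xs) (there x∈)  px with p y
... | true  = there (filterB-∈⁺ p xs x∈ px)
... | false = filterB-∈⁺ p xs x∈ px

filterB-unique : ∀ p {xs} → Unique xs → Unique (filterB p xs)
filterB-unique p {[]}     _        = []
filterB-unique p {y ∷ xs} (y∉ ∷ u) with p y
... | true  = All.tabulate (All.lookup y∉ ∘ proj₁ ∘ filterB-∈⁻ p xs) ∷ filterB-unique p u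
... | false = filterB-unique p u

countB-filterB : ∀ p q xs → countB (λ x → p x ∧ q x) xs ≡ countB q (filterB p xs)
countB-filterB p q []       = refl
countB-filterB p q (x ∷ xs) with p x
... | true  = cong (𝟙 (q x) +_) (countB-filterB p q xs)
... | false = countB-filterB p q xs

distinct⇒Unique : ∀ xs → distinct xs ≡ true → Unique xs
distinct⇒Unique []       _ = []
distinct⇒Unique (x ∷ xs) e with any (x ≡ᵇ_) xs in none
... | false = All.tabulate (λ {y} y∈ x≡y → x∉ y∈ x≡y) ∷ distinct⇒Unique xs e
  where
  x∉ : ∀ {y} → y ∈ xs → x ≢ y
  x∉ y∈ refl with () ← trans (sym none) (any-true (x ≡ᵇ_) xs y∈ (≡ᵇ-refl x))

Unique⇒distinct : ∀ xs → Unique xs → distinct xs ≡ true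
Unique⇒distinct []       _        = refl
Unique⇒distinct (x ∷ xs) (x∉ ∷ u)
  rewrite any-false (x ≡ᵇ_) xs (λ y∈ → ≢⇒≡ᵇ-false (All.lookup x∉ y∈)) = Unique⇒distinct xs u

perms-∈⁻ : ∀ n {π} → π ∈ perms n → IsPerm n π
perms-∈⁻ n {π} π∈ with filterB-∈⁻ distinct (words n n) π∈
... | π∈words , dist with words-∈⁻ n n π∈words
... | len , range = mkPerm len range (distinct⇒Unique π dist)

perms-∈⁺ : ∀ n {π} → IsPerm n π → π ∈ perms n
perms-∈⁺ n {π} (mkPerm len range u) = filterB-∈⁺ distinct (words n n) (words-∈⁺ n n len range) (Unique⇒distinct π u)

motzkins : ℕ → List (List ℕ)
motzkins n = filterB isMotzkin (perms n)

motzkins-∈⁻ : ∀ n {π} → π ∈ motzkins n → IsPerm n π × isMotzkin π ≡ true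
motzkins-∈⁻ n π∈ = let π∈perms , mot = filterB-∈⁻ isMotzkin (perms n) π∈ in perms-∈⁻ n π∈perms , mot

motzkins-∈⁺ : ∀ n {π} → IsPerm n π → isMotzkin π ≡ true → π ∈ motzkins n
motzkins-∈⁺ n perm mot = filterB-∈⁺ isMotzkin (perms n) (perms-∈⁺ n perm) mot

motzkins-unique : ∀ n → Unique (motzkins n)
motzkins-unique n = filterB-unique isMotzkin (filterB-unique distinct (words-unique n n))

motzkins-length : ∀ n {π} → π ∈ motzkins n → length π ≡ n
motzkins-length n π∈ = IsPerm.length≡ (proj₁ (motzkins-∈⁻ n π∈))

IsPerm-∋max : ∀ n {π} → IsPerm (suc n) π → suc n ∈ π
IsPerm-∋max n {π} (mkPerm len range u) with DecMembership._∈?_ _≟_ (suc n) π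
... | yes n+1∈ = n+1∈
... | no  n+1∉ = ⊥-elim (1+n≰n (begin
  suc n          ≡⟨ len ⟨
  length π       ≤⟨ Unique-bounded-length (suc n) π u (All.tabulate below) ⟩
  suc n ∸ 1      ≡⟨⟩
  n              ∎))
  where
  open ≤-Reasoning
  below : ∀ {x} → x ∈ π → 1 ≤ x × x < suc n
  below {x} x∈ = let 1≤x , x≤n+1 = All.lookup range x∈
                 in 1≤x , ≤∧≢⇒< x≤n+1 (λ x≡n+1 → n+1∉ (subst (_∈ π) x≡n+1 x∈))

consMax : List ℕ → List ℕ
consMax ρ = suc (length ρ) ∷ ρ

splice : List ℕ → List ℕ → List ℕ
splice σ ρ = map (_+ suc (length ρ)) σ ++ suc (length ρ) ∷ suc (suc (length σ + length ρ)) ∷ ρ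

IsPerm⇒InRange-length : ∀ {n π} → IsPerm n π → InRange (length π) π
IsPerm⇒InRange-length (mkPerm refl range _) = range

monOf-consMax : ∀ ρ → All (_≤ length ρ) ρ → monOf (consMax ρ) ≋ x₁ · monOf ρ
monOf-consMax ρ ρ≤ = mk≋ (λ t → begin
  deg t (monOf (consMax ρ))                      ≡⟨ deg-monOf t (consMax ρ) ⟩
  incAbove t (suc (length ρ)) ρ + inc (suc t) ρ  ≡⟨ cong₂ _+_ (incAbove-max (suc (length ρ)) ρ (All.map s≤s ρ≤) t)
                                                                (sym (deg-monOf t ρ)) ⟩
  deg t x₁ + deg t (monOf ρ)                     ≡⟨ deg-· t x₁ (monOf ρ) ⟨
  deg t (x₁ · monOf ρ)                           ∎)
  where open ≡-Reasoning

consMax-∈ : ∀ n {ρ} → ρ ∈ motzkins n → consMax ρ ∈ motzkins (suc n)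
consMax-∈ n {ρ} ρ∈ with motzkins-∈⁻ n ρ∈
... | mkPerm refl range u , mot = motzkins-∈⁺ (suc n) perm motzkin
  where
  ρ≤n : All (_≤ n) ρ
  ρ≤n = All.map proj₂ range
  perm : IsPerm (suc n) (consMax ρ)
  perm = mkPerm refl ((s≤s z≤n , ≤-refl) ∷ All.map (λ (1≤x , x≤n) → 1≤x , m≤n⇒m≤1+n x≤n) range)
                (All.map (λ x≤n n+1≡x → <-irrefl (sym n+1≡x) (s≤s x≤n)) ρ≤n ∷ u)
  motzkin : isMotzkin (consMax ρ) ≡ true
  motzkin = isMotzkin-intro (consMax ρ)
    (trans (cong (_∨ has132 ρ) (has132Above-below (suc n) ρ (All.map m≤n⇒m≤1+n ρ≤n))) (isMotzkin⇒no132 ρ mot))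
    (begin
      bad1-23 [] (suc n ∷ ρ)          ≡⟨ bad1-23-max-∷ (suc n) ρ [] (All.map m≤n⇒m≤1+n ρ≤n) ⟩
      bad1-23 (suc n ∷ []) ρ          ≡⟨ bad1-23-history-above (suc n) [ suc n ] (≤-refl ∷ []) ρ [] (All.map s≤s ρ≤n) ⟩
      bad1-23 [] ρ                    ≡⟨ isMotzkin⇒no1-23 ρ mot ⟩
      false                           ∎)
    where open ≡-Reasoning

module Splice (σ ρ : List ℕ) (σ-range : InRange (length σ) σ) (ρ-range : InRange (length ρ) ρ) where

  u N : ℕ
  u = suc (length ρ)
  N = suc (suc (length σ + length ρ))

  σ′ : List ℕ
  σ′ = map (_+ u) σ

  σ′-between : All (λ x → u < x × x < N) σ′
  σ′-between = All.map⁺ (All.map (λ (1≤x , x≤i) →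
    +-monoˡ-≤ u 1≤x , s≤s (≤-trans (+-monoˡ-≤ u x≤i) (≤-reflexive (+-suc (length σ) (length ρ))))) σ-range)

  ρ-below : All (_< u) ρ
  ρ-below = All.map (s≤s ∘ proj₂) ρ-range

  u<N : u < N
  u<N = s≤s (s≤s (m≤n+m (length ρ) (length σ)))

  front-above : All (u ≤_) (σ′ ++ u ∷ N ∷ [])
  front-above = All.++⁺ (All.map (<⇒≤ ∘ proj₁) σ′-between) (≤-refl ∷ <⇒≤ u<N ∷ [])

  splice≡ : splice σ ρ ≡ (σ′ ++ u ∷ N ∷ []) ++ ρ
  splice≡ = sym (List.++-assoc σ′ (u ∷ N ∷ []) ρ)

  length-splice : length (splice σ ρ) ≡ N
  length-splice = begin
    length (σ′ ++ u ∷ N ∷ ρ)            ≡⟨ List.length-++ σ′ ⟩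
    length σ′ + suc (suc (length ρ))    ≡⟨ cong (_+ suc u) (List.length-map (_+ u) σ) ⟩
    length σ + suc (suc (length ρ))     ≡⟨ +-suc (length σ) (suc (length ρ)) ⟩
    suc (length σ + suc (length ρ))     ≡⟨ cong suc (+-suc (length σ) (length ρ)) ⟩
    N                                   ∎
    where open ≡-Reasoning

  splice-InRange : InRange N (splice σ ρ)
  splice-InRange = All.++⁺ (All.map (λ (u<x , x<N) → ≤-trans (s≤s z≤n) u<x , <⇒≤ x<N) σ′-between)
    ((s≤s z≤n , <⇒≤ u<N) ∷ (s≤s z≤n , ≤-refl) ∷ All.map (λ (1≤y , y≤j) → 1≤y , ≤-trans y≤j (<⇒≤ (<-trans (n<1+n _) u<N))) ρ-range)

  splice-unique : Unique σ → Unique ρ → Unique (splice σ ρ)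
  splice-unique σ-unique ρ-unique = Unique.++⁺ (Unique.map⁺ (+-cancelʳ-≡ u _ _) σ-unique)
    ((<⇒≢ u<N ∷ All.map (λ y<u u≡y → <-irrefl (sym u≡y) y<u) ρ-below)
     ∷ All.map (λ y<u N≡y → <-irrefl (sym N≡y) (<-trans y<u u<N)) ρ-below ∷ ρ-unique)
    disjoint
    where
    disjoint : ∀ {v} → ¬ (v ∈ σ′ × v ∈ u ∷ N ∷ ρ)
    disjoint (v∈σ′ , here refl)         = <-irrefl refl (proj₁ (All.lookup σ′-between v∈σ′))
    disjoint (v∈σ′ , there (here refl)) = <-irrefl refl (proj₂ (All.lookup σ′-between v∈σ′))
    disjoint (v∈σ′ , there (there v∈ρ)) = <-irrefl refl (<-trans (All.lookup ρ-below v∈ρ) (proj₁ (All.lookup σ′-between v∈σ′)))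

  uN-cross : ∀ {x b c} → x ∈ σ′ → b ∈ σ′ → c ∈ u ∷ N ∷ [] → ((x <ᵇ c) ∧ (c <ᵇ b)) ≡ false
  uN-cross {x} x∈ _ (here refl) rewrite ≥⇒<ᵇ-false {x} {u} (<⇒≤ (proj₁ (All.lookup σ′-between x∈))) = refl
  uN-cross {x} _ b∈ (there (here refl))
    rewrite ≥⇒<ᵇ-false {N} (<⇒≤ (proj₂ (All.lookup σ′-between b∈))) = ∧-zeroʳ (x <ᵇ N)

  uN-no132Above : ∀ {x} → x ∈ σ′ → has132Above x (u ∷ N ∷ []) ≡ false
  uN-no132Above {x} _ rewrite ≥⇒<ᵇ-false {N} {u} (<⇒≤ u<N) | ∧-zeroʳ (x <ᵇ N) = refl

  splice-no132 : has132 σ ≡ false → has132 ρ ≡ false → has132 (splice σ ρ) ≡ false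
  splice-no132 σ-no132 ρ-no132 rewrite splice≡
    | has132-++ (σ′ ++ u ∷ N ∷ []) ρ
        (λ {x} {b} {c} x∈ _ c∈ → cong (_∧ (c <ᵇ b)) (≥⇒<ᵇ-false (<⇒≤ (≤-trans (All.lookup ρ-below c∈) (All.lookup front-above x∈)))))
        (λ x∈ → has132Above-below _ ρ (All.map (λ y<u → <⇒≤ (≤-trans y<u (All.lookup front-above x∈))) ρ-below))
    | has132-++ σ′ (u ∷ N ∷ []) uN-cross uN-no132Above
    | has132-+ʳ u σ | σ-no132 | ρ-no132 = refl

  splice-no1-23 : bad1-23 [] σ ≡ false → bad1-23 [] ρ ≡ false → bad1-23 [] (splice σ ρ) ≡ false
  splice-no1-23 σ-no1-23 ρ-no1-23
    rewrite bad1-23-split [] σ′ u (N ∷ ρ) | bad1-23-∷ʳ-below [] σ′ u (All.map proj₁ σ′-between)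
          | bad1-23-+ʳ u [] σ | σ-no1-23 | <⇒<ᵇ′ u<N | any-reverseAcc (_<ᵇ u) [] σ′
          | any-false (_<ᵇ u) σ′ (λ x∈ → ≥⇒<ᵇ-false (<⇒≤ (proj₁ (All.lookup σ′-between x∈))))
          | bad1-23-max-∷ N ρ (u ∷ reverseAcc [] σ′) (All.map (λ y<u → <⇒≤ (<-trans y<u u<N)) ρ-below)
          | bad1-23-history-above u (N ∷ u ∷ reverseAcc [] σ′)
              (<⇒≤ u<N ∷ ≤-refl ∷ All-reverseAcc [] σ′ [] (All.map (<⇒≤ ∘ proj₁) σ′-between)) ρ [] ρ-below
          | ρ-no1-23 = refl

  monOf-splice : monOf (splice σ ρ) ≋ x₁²x₂ · shift (monOf σ) · monOf ρ
  monOf-splice = mk≋ (λ t → begin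
    deg t (monOf (splice σ ρ))
      ≡⟨ deg-monOf t (splice σ ρ) ⟩
    inc (suc t) (splice σ ρ)
      ≡⟨ cong (inc (suc t)) splice≡ ⟩
    inc (suc t) ((σ′ ++ u ∷ N ∷ []) ++ ρ)
      ≡⟨ inc-++-below u (σ′ ++ u ∷ N ∷ []) ρ front-above ρ-below t ⟩
    inc (suc t) (σ′ ++ u ∷ N ∷ []) + inc (suc t) ρ
      ≡⟨ cong (_+ inc (suc t) ρ) (inc-++-uN u N σ′ u<N σ′-between t) ⟩
    (inc (suc t) σ′ + incBefore t σ′) + deg t x₁²x₂ + inc (suc t) ρ
      ≡⟨ cong (λ k → k + deg t x₁²x₂ + inc (suc t) ρ) (cong₂ _+_ (inc-+ʳ u (suc t) σ) (incBefore-+ʳ t)) ⟩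
    (inc (suc t) σ + incBefore t σ) + deg t x₁²x₂ + inc (suc t) ρ
      ≡⟨ cong (_+ inc (suc t) ρ) (+-comm _ (deg t x₁²x₂)) ⟩
    deg t x₁²x₂ + (inc (suc t) σ + incBefore t σ) + inc (suc t) ρ
      ≡⟨ cong₂ (λ a b → deg t x₁²x₂ + a + b) (cong₂ _+_ (deg-monOf t σ) (degBefore-monOf t)) (deg-monOf t ρ) ⟨
    deg t x₁²x₂ + (deg t (monOf σ) + degBefore t (monOf σ)) + deg t (monOf ρ)
      ≡⟨ cong (λ a → deg t x₁²x₂ + a + deg t (monOf ρ)) (deg-shift t (monOf σ)) ⟨
    deg t x₁²x₂ + deg t (shift (monOf σ)) + deg t (monOf ρ)
      ≡⟨ cong (_+ deg t (monOf ρ)) (deg-· t x₁²x₂ (shift (monOf σ))) ⟨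
    deg t (x₁²x₂ · shift (monOf σ)) + deg t (monOf ρ)
      ≡⟨ deg-· t (x₁²x₂ · shift (monOf σ)) (monOf ρ) ⟨
    deg t (x₁²x₂ · shift (monOf σ) · monOf ρ)
      ∎)
    where
    open ≡-Reasoning
    incBefore-+ʳ : ∀ t → incBefore t σ′ ≡ incBefore t σ
    incBefore-+ʳ zero    = refl
    incBefore-+ʳ (suc t) = inc-+ʳ u (suc t) σ
    degBefore-monOf : ∀ t → degBefore t (monOf σ) ≡ incBefore t σ
    degBefore-monOf zero    = refl
    degBefore-monOf (suc t) = deg-monOf t σ

splice-∈ : ∀ i j {σ ρ} → σ ∈ motzkins i → ρ ∈ motzkins j → splice σ ρ ∈ motzkins (suc (suc (i + j)))
splice-∈ i j {σ} {ρ} σ∈ ρ∈ with motzkins-∈⁻ i σ∈ | motzkins-∈⁻ j ρ∈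
... | σ-perm@(mkPerm refl _ σ-unique) , σ-mot | ρ-perm@(mkPerm refl _ ρ-unique) , ρ-mot =
  motzkins-∈⁺ _ (mkPerm length-splice splice-InRange (splice-unique σ-unique ρ-unique))
    (isMotzkin-intro (splice σ ρ) (splice-no132 (isMotzkin⇒no132 σ σ-mot) (isMotzkin⇒no132 ρ ρ-mot))
                                  (splice-no1-23 (isMotzkin⇒no1-23 σ σ-mot) (isMotzkin⇒no1-23 ρ ρ-mot)))
  where open Splice σ ρ (IsPerm⇒InRange-length σ-perm) (IsPerm⇒InRange-length ρ-perm)

splicePairs : ℕ → List (List ℕ × List ℕ)
splicePairs n = concatMap (λ i → concatMap (λ σ → map (σ ,_) (motzkins (n ∸ suc i))) (motzkins i)) (upTo n)

decompositions : ℕ → List (List ℕ)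
decompositions n = map consMax (motzkins n) ++ map (uncurry splice) (splicePairs n)

splicePairs-∈⁻ : ∀ n {σ ρ} → (σ , ρ) ∈ splicePairs n → ∃ λ i → i < n × σ ∈ motzkins i × ρ ∈ motzkins (n ∸ suc i)
splicePairs-∈⁻ n p∈ with find (∈-concatMap⁻ (λ i → concatMap (λ σ → map (σ ,_) (motzkins (n ∸ suc i))) (motzkins i)) {xs = upTo n} p∈)
... | i , i∈ , p∈i with find (∈-concatMap⁻ (λ σ → map (σ ,_) (motzkins (n ∸ suc i))) {xs = motzkins i} p∈i)
... | σ , σ∈ , p∈σ with ∈-map⁻ (σ ,_) p∈σ
... | ρ , ρ∈ , refl = i , ∈-upTo⁻ i∈ , σ∈ , ρ∈

splicePairs-∈⁺ : ∀ n {i σ ρ} → i < n → σ ∈ motzkins i → ρ ∈ motzkins (n ∸ suc i) → (σ , ρ) ∈ splicePairs n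
splicePairs-∈⁺ n {i} {σ} {ρ} i<n σ∈ ρ∈ =
  ∈-concatMap⁺ (λ i → concatMap (λ σ → map (σ ,_) (motzkins (n ∸ suc i))) (motzkins i)) (lose (∈-upTo⁺ i<n)
    (∈-concatMap⁺ (λ σ → map (σ ,_) (motzkins (n ∸ suc i))) (lose σ∈ (∈-map⁺ (σ ,_) ρ∈))))

decompositions⊆motzkins : ∀ n {z} → z ∈ decompositions n → z ∈ motzkins (suc n)
decompositions⊆motzkins n z∈ with ∈-++⁻ (map consMax (motzkins n)) z∈
... | inj₁ z∈consMax = let ρ , ρ∈ , z≡ = ∈-map⁻ consMax z∈consMax in subst (_∈ motzkins (suc n)) (sym z≡) (consMax-∈ n ρ∈)
... | inj₂ z∈splice with ∈-map⁻ (uncurry splice) z∈splice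
... | (σ , ρ) , p∈ , refl = let i , i<n , σ∈ , ρ∈ = splicePairs-∈⁻ n p∈ in
  subst (λ k → splice σ ρ ∈ motzkins k) (cong suc (m+[n∸m]≡n i<n)) (splice-∈ i (n ∸ suc i) σ∈ ρ∈)

module Unsplice (n : ℕ) (α′ ρ : List ℕ) (u : ℕ) (z-perm : IsPerm (suc n) (α′ ++ u ∷ suc n ∷ ρ))
  (z-mot : isMotzkin (α′ ++ u ∷ suc n ∷ ρ) ≡ true) (above : ∀ {a c} → a ∈ α′ ++ [ u ] → c ∈ ρ → c < a) where

  open IsPerm z-perm

  N i j : ℕ
  N = suc n
  i = length α′
  j = length ρ

  z : List ℕ
  z = α′ ++ u ∷ N ∷ ρ

  range : ∀ {x} → x ∈ z → 1 ≤ x × x ≤ N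
  range = All.lookup inRange

  u∈z : u ∈ z
  u∈z = ∈-++⁺ʳ α′ (here refl)

  ρ<u : All (_< u) ρ
  ρ<u = All.tabulate (above (∈-++⁺ʳ α′ (here refl)))

  u<N : u < N
  u<N = ≤∧≢⇒< (proj₂ (range u∈z)) (All.lookup (AllPairs.head (Unique-++ʳ α′ unique)) (here refl))

  -- An entry a < u before u would give the 1-23 occurrence a u N.
  α′>u : All (u <_) α′
  α′>u = All.tabulate u<a
    where
    u<a : ∀ {a} → a ∈ α′ → u < a
    u<a {a} a∈ with <-cmp a u
    ... | tri< a<u _ _ with () ← trans (sym (bad1-23-witness [] α′ u N ρ a∈ a<u u<N)) (isMotzkin⇒no1-23 z z-mot)
    ... | tri≈ _ a≡u _ = ⊥-elim (Unique-++-disjoint α′ unique a∈ (here refl) a≡u)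
    ... | tri> _ _ u<a = u<a

  α′<N : All (_< N) α′
  α′<N = All.tabulate (λ a∈ → ≤∧≢⇒< (proj₂ (range (∈-++⁺ˡ a∈))) (Unique-++-disjoint α′ unique a∈ (there (here refl))))

  ρ≥1 : All (1 ≤_) ρ
  ρ≥1 = All.tabulate (λ c∈ → proj₁ (range (∈-++⁺ʳ α′ (there (there c∈)))))

  α′-unique : Unique α′
  α′-unique = Unique-++ˡ α′ unique

  ρ-unique : Unique ρ
  ρ-unique = Unique-++ʳ (u ∷ N ∷ []) (Unique-++ʳ α′ unique)

  i+2+j≡N : i + suc (suc j) ≡ N
  i+2+j≡N = trans (sym (List.length-++ α′)) length≡

  -- Counting: α′ has i distinct entries in (u, N) and ρ has j distinct entries in [1, u).
  u≡1+j : u ≡ suc j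
  u≡1+j = ≤-antisym u≤1+j 1+j≤u
    where
    i≤ : i ≤ N ∸ suc u
    i≤ = Unique-bounded-length N α′ α′-unique (All.zipWith (λ (u<a , a<N) → u<a , a<N) (α′>u , α′<N))
    j≤ : j ≤ u ∸ 1
    j≤ = Unique-bounded-length u ρ ρ-unique (All.zipWith (λ (1≤c , c<u) → 1≤c , c<u) (ρ≥1 , ρ<u))
    u≤1+j : u ≤ suc j
    u≤1+j = ≤-pred (+-cancelˡ-≤ i (suc u) (suc (suc j)) (begin
      i + suc u              ≤⟨ +-monoˡ-≤ (suc u) i≤ ⟩
      N ∸ suc u + suc u      ≡⟨ m∸n+n≡m u<N ⟩
      N                      ≡⟨ i+2+j≡N ⟨
      i + suc (suc j)        ∎))
      where open ≤-Reasoning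
    1+j≤u : suc j ≤ u
    1+j≤u = begin
      suc j                  ≡⟨ +-comm 1 j ⟩
      j + 1                  ≤⟨ +-monoˡ-≤ 1 j≤ ⟩
      u ∸ 1 + 1              ≡⟨ m∸n+n≡m (proj₁ (range u∈z)) ⟩
      u                      ∎
      where open ≤-Reasoning

  σ : List ℕ
  σ = map (_∸ u) α′

  α′≡ : map (_+ u) σ ≡ α′
  α′≡ = trans (sym (List.map-∘ α′)) (List.map-id-local (All.map m∸n+n≡m (All.map <⇒≤ α′>u)))

  N≡ : suc (suc (i + j)) ≡ N
  N≡ = trans (cong suc (sym (+-suc i j))) (trans (sym (+-suc i (suc j))) i+2+j≡N)

  σ-perm : IsPerm i σ
  σ-perm = mkPerm (List.length-map (_∸ u) α′)
    (All.map⁺ (All.zipWith (λ (u<a , a<N) → m<n⇒0<n∸m u<a , a∸u≤i a<N) (α′>u , α′<N)))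
    (Unique.map⁻ (subst Unique (sym α′≡) α′-unique))
    where
    a∸u≤i : ∀ {a} → a < N → a ∸ u ≤ i
    a∸u≤i {a} a<N = begin
      a ∸ u            ≤⟨ ∸-monoˡ-≤ u (≤-pred (subst (a <_) N≡′ a<N)) ⟩
      i + u ∸ u        ≡⟨ m+n∸n≡m i u ⟩
      i                ∎
      where
      open ≤-Reasoning
      N≡′ : N ≡ suc (i + u)
      N≡′ = trans (sym i+2+j≡N) (trans (cong (λ k → i + suc k) (sym u≡1+j)) (+-suc i u))

  ρ-perm : IsPerm j ρ
  ρ-perm = mkPerm refl (All.zipWith (λ (1≤c , c<u) → 1≤c , ≤-pred (subst (_ <_) u≡1+j c<u)) (ρ≥1 , ρ<u)) ρ-unique

  σ-mot : isMotzkin σ ≡ true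
  σ-mot = isMotzkin-+ʳ u σ (subst (λ xs → isMotzkin xs ≡ true) (sym α′≡) (isMotzkin-prefix α′ (u ∷ N ∷ ρ) z-mot))

  ρ-mot : isMotzkin ρ ≡ true
  ρ-mot = isMotzkin-suffix (α′ ++ u ∷ N ∷ []) ρ
    (subst (λ xs → isMotzkin xs ≡ true) (sym (List.++-assoc α′ (u ∷ N ∷ []) ρ)) z-mot)

  splice≡z : splice σ ρ ≡ z
  splice≡z = begin
    splice σ ρ                 ≡⟨ cong₂ (λ k l → map (_+ k) σ ++ k ∷ l ∷ ρ) (sym u≡1+j)
                                        (trans (cong (λ k → suc (suc (k + j))) (IsPerm.length≡ σ-perm)) N≡) ⟩
    map (_+ u) σ ++ u ∷ N ∷ ρ  ≡⟨ cong (_++ u ∷ N ∷ ρ) α′≡ ⟩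
    z                          ∎
    where open ≡-Reasoning

  i<n : i < n
  i<n = subst (i <_) (suc-injective N≡) (s≤s (m≤m+n i j))

  z∈decompositions : z ∈ decompositions n
  z∈decompositions = subst (_∈ decompositions n) splice≡z (∈-++⁺ʳ (map consMax (motzkins n)) (∈-map⁺ (uncurry splice)
    (splicePairs-∈⁺ n i<n (motzkins-∈⁺ i σ-perm σ-mot)
      (subst (λ k → ρ ∈ motzkins k) (sym n∸1+i≡j) (motzkins-∈⁺ j ρ-perm ρ-mot)))))
    where
    n∸1+i≡j : n ∸ suc i ≡ j
    n∸1+i≡j = trans (cong (_∸ suc i) (sym (suc-injective N≡))) (m+n∸m≡n i j)

motzkins⊆decompositions : ∀ n {z} → z ∈ motzkins (suc n) → z ∈ decompositions n
motzkins⊆decompositions n z∈ with motzkins-∈⁻ (suc n) z∈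
... | z-perm , z-mot with ∈-∃++ (IsPerm-∋max n z-perm)
... | α , ρ , refl with initLast α
... | [] = subst (_∈ decompositions n) (cong (λ k → suc k ∷ ρ) ρ-length) (∈-++⁺ˡ (∈-map⁺ consMax ρ∈))
  where
  open IsPerm z-perm
  ρ-length : length ρ ≡ n
  ρ-length = suc-injective length≡
  ρ∈ : ρ ∈ motzkins n
  ρ∈ = motzkins-∈⁺ n (mkPerm ρ-length
    (All.tabulate (λ {c} c∈ → let 1≤c , c≤N = All.lookup (All.tail inRange) c∈
                             in 1≤c , ≤-pred (≤∧≢⇒< c≤N (λ c≡N → All.lookup (AllPairs.head unique) c∈ (sym c≡N)))))
    (AllPairs.tail unique))
    (isMotzkin-suffix [ suc n ] ρ z-mot)
... | α′ ∷ʳ′ u = subst (_∈ decompositions n) (sym z≡) (Unsplice.z∈decompositions n α′ ρ u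
  (subst (IsPerm (suc n)) z≡ z-perm) (subst (λ xs → isMotzkin xs ≡ true) z≡ z-mot) above)
  where
  z≡ : (α′ ++ [ u ]) ++ suc n ∷ ρ ≡ α′ ++ u ∷ suc n ∷ ρ
  z≡ = List.++-assoc α′ [ u ] (suc n ∷ ρ)
  open IsPerm z-perm
  ρ<N : ∀ {c} → c ∈ ρ → c < suc n
  ρ<N c∈ = ≤∧≢⇒< (proj₂ (All.lookup inRange (∈-++⁺ʳ (α′ ++ [ u ]) (there c∈))))
                 (λ c≡N → All.lookup (AllPairs.head (Unique-++ʳ (α′ ++ [ u ]) unique)) c∈ (sym c≡N))
  -- An entry c after N above an entry a before N would give the 132 occurrence a N c.
  above : ∀ {a c} → a ∈ α′ ++ [ u ] → c ∈ ρ → c < a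
  above {a} {c} a∈ c∈ with <-cmp a c
  ... | tri< a<c _ _ with () ← trans (sym (has132-witness (α′ ++ [ u ]) ρ (suc n) a∈ c∈ a<c (ρ<N c∈))) (isMotzkin⇒no132 ((α′ ++ [ u ]) ++ suc n ∷ ρ) z-mot)
  ... | tri≈ _ a≡c _ = ⊥-elim (Unique-++-disjoint (α′ ++ [ u ]) unique a∈ (there c∈) a≡c)
  ... | tri> _ _ c<a = c<a

Unique-split-at : ∀ {x : A} (xs₁ ys₁ xs₂ ys₂ : List A) → Unique (xs₁ ++ x ∷ ys₁) → xs₁ ++ x ∷ ys₁ ≡ xs₂ ++ x ∷ ys₂ →
                  xs₁ ≡ xs₂ × ys₁ ≡ ys₂
Unique-split-at []         ys₁ []         ys₂ _ eq = refl , List.∷-injectiveʳ eq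
Unique-split-at []         ys₁ (y ∷ xs₂)  ys₂ (x∉ ∷ _) eq with refl ← List.∷-injectiveˡ eq =
  ⊥-elim (All.lookup x∉ (subst (_ ∈_) (sym (List.∷-injectiveʳ eq)) (∈-++⁺ʳ xs₂ (here refl))) refl)
Unique-split-at (y ∷ xs₁)  ys₁ []         ys₂ (y∉ ∷ _) eq with refl ← List.∷-injectiveˡ eq =
  ⊥-elim (All.lookup y∉ (∈-++⁺ʳ xs₁ (here refl)) refl)
Unique-split-at (y ∷ xs₁)  ys₁ (y′ ∷ xs₂) ys₂ (_ ∷ u) eq =
  let xs≡ , ys≡ = Unique-split-at xs₁ ys₁ xs₂ ys₂ u (List.∷-injectiveʳ eq) in cong₂ _∷_ (List.∷-injectiveˡ eq) xs≡ , ys≡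

splicePairs-unique : ∀ n → Unique (splicePairs n)
splicePairs-unique n = Unique-concatMap _ (length ∘ proj₁) (Unique.upTo⁺ n)
  (λ i → Unique-concatMap (λ σ → map (σ ,_) (motzkins (n ∸ suc i))) proj₁ (motzkins-unique i)
           (λ σ → Unique.map⁺ (cong proj₂) (motzkins-unique (n ∸ suc i))) first≡)
  length≡
  where
  first≡ : ∀ {i σ p} → p ∈ map (σ ,_) (motzkins (n ∸ suc i)) → proj₁ p ≡ σ
  first≡ {σ = σ} p∈ with ∈-map⁻ (σ ,_) p∈
  ... | _ , _ , refl = refl
  length≡ : ∀ {i p} → p ∈ concatMap (λ σ → map (σ ,_) (motzkins (n ∸ suc i))) (motzkins i) → length (proj₁ p) ≡ i
  length≡ {i} p∈ with find (∈-concatMap⁻ (λ σ → map (σ ,_) (motzkins (n ∸ suc i))) {xs = motzkins i} p∈)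
  ... | σ , σ∈ , p∈σ with ∈-map⁻ (σ ,_) p∈σ
  ... | _ , _ , refl = motzkins-length i σ∈

module SplicedPair (n : ℕ) {σ ρ : List ℕ} (p∈ : (σ , ρ) ∈ splicePairs n) where

  front : List ℕ
  front = map (_+ suc (length ρ)) σ ++ [ suc (length ρ) ]

  shape : splice σ ρ ≡ front ++ suc n ∷ ρ
  shape with splicePairs-∈⁻ n p∈
  ... | i , i<n , σ∈ , ρ∈ rewrite motzkins-length i σ∈ | motzkins-length (n ∸ suc i) ρ∈ =
    trans (sym (List.++-assoc (map (_+ suc (n ∸ suc i)) σ) _ _)) (cong (λ k → front′ ++ suc k ∷ ρ) (m+[n∸m]≡n i<n))
    where
    front′ = map (_+ suc (n ∸ suc i)) σ ++ [ suc (n ∸ suc i) ]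

  unique : Unique (front ++ suc n ∷ ρ)
  unique = subst Unique shape (IsPerm.unique (proj₁ (motzkins-∈⁻ (suc n) (decompositions⊆motzkins n
             (∈-++⁺ʳ (map consMax (motzkins n)) (∈-map⁺ (uncurry splice) p∈))))))

  front≢[] : front ≢ []
  front≢[] eq with () ← List.++-conicalʳ (map (_+ suc (length ρ)) σ) [ suc (length ρ) ] eq

front-injective : ∀ (σ₁ σ₂ ρ : List ℕ) → map (_+ suc (length ρ)) σ₁ ++ [ suc (length ρ) ] ≡ map (_+ suc (length ρ)) σ₂ ++ [ suc (length ρ) ] →
                  σ₁ ≡ σ₂
front-injective σ₁ σ₂ ρ eq = List.map-injective (λ {a} {b} → +-cancelʳ-≡ (suc (length ρ)) a b)
  (proj₁ (List.∷ʳ-injective (map (_+ suc (length ρ)) σ₁) (map (_+ suc (length ρ)) σ₂) eq))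

splice-injective : ∀ n {p q} → p ∈ splicePairs n → q ∈ splicePairs n → uncurry splice p ≡ uncurry splice q → p ≡ q
splice-injective n {σ₁ , ρ₁} {σ₂ , ρ₂} p∈ q∈ eq = cong₂ _,_ σ≡ ρ≡
  where
  module P = SplicedPair n p∈
  module Q = SplicedPair n q∈
  parts : P.front ≡ Q.front × ρ₁ ≡ ρ₂
  parts = Unique-split-at P.front ρ₁ Q.front ρ₂ P.unique (trans (sym P.shape) (trans eq Q.shape))
  ρ≡ : ρ₁ ≡ ρ₂
  ρ≡ = proj₂ parts
  σ≡ : σ₁ ≡ σ₂
  σ≡ = front-injective σ₁ σ₂ ρ₁ (trans (proj₁ parts) (cong (λ ρ → map (_+ suc (length ρ)) σ₂ ++ [ suc (length ρ) ]) (sym ρ≡)))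

decompositions-unique : ∀ n → Unique (decompositions n)
decompositions-unique n = Unique.++⁺ (Unique.map⁺ List.∷-injectiveʳ (motzkins-unique n))
  (Unique-map-on (uncurry splice) (splice-injective n) (splicePairs-unique n)) disjoint
  where
  disjoint : ∀ {z} → ¬ (z ∈ map consMax (motzkins n) × z ∈ map (uncurry splice) (splicePairs n))
  disjoint (z∈₁ , z∈₂) with ∈-map⁻ consMax z∈₁ | ∈-map⁻ (uncurry splice) z∈₂
  ... | ρ , ρ∈ , refl | (σ′ , ρ′) , p∈ , z≡ = P.front≢[] (sym (proj₁ (Unique-split-at [] ρ P.front ρ′
        (subst (λ k → Unique (k ∷ ρ)) N≡ (IsPerm.unique (proj₁ (motzkins-∈⁻ (suc n) (consMax-∈ n ρ∈)))))
        (trans (cong (_∷ ρ) (sym N≡)) (trans z≡ P.shape)))))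
    where
    module P = SplicedPair n p∈
    N≡ : suc (length ρ) ≡ suc n
    N≡ = cong suc (motzkins-length n ρ∈)

count-motzkins-suc : ∀ n (p : List ℕ → Bool) →
  count p (motzkins (suc n)) ≡ count p (map consMax (motzkins n)) + count p (map (uncurry splice) (splicePairs n))
count-motzkins-suc n p = trans
  (count-sameMembers p (motzkins-unique (suc n)) (decompositions-unique n) (motzkins⊆decompositions n) (decompositions⊆motzkins n))
  (∑-++ _ (map consMax (motzkins n)) _)

-- At depth k of the recursion a block is weighted with k shifts, i.e. with xⱼ ↦ ∏ᵢ x_{j+i}^C(k,i).
weight : ℕ → List ℕ → Mon
weight k π = shift^ k (monOf π)

motzkinGF : ℕ → Seriesᴺ
motzkinGF k = countSeries motzkins (weight k)

tailGF : ℕ → Seriesᴺ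
tailGF k = monoᴺ (aMon (suc k)) +ᴺ monoᴺ (bMon (suc k)) *ᴺ motzkinGF (suc k)

lhsCoeff≡motzkinGF : ∀ m → lhsCoeff m ≡ motzkinGF 0 m
lhsCoeff≡motzkinGF m = begin
  lhsCoeff m                                             ≡⟨ countB-filterB isMotzkin (λ π → monEq (monOf π) m) (perms (exp₁ m)) ⟩
  countB (λ π → monEq (monOf π) m) (motzkins (exp₁ m))   ≡⟨ countB≡count _ (motzkins (exp₁ m)) ⟩
  count (λ π → monEq (monOf π) m) (motzkins (exp₁ m))    ≡⟨ cong (λ e → count (λ π → monEq (monOf π) m) (motzkins e)) (exp₁≡deg₀ m) ⟩
  motzkinGF 0 m                                          ∎
  where open ≡-Reasoning

motzkins-graded : ∀ k → Graded motzkins (weight k)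
motzkins-graded k i = All.tabulate (λ {π} π∈ → trans (deg₀-shift^ k (monOf π)) (trans (deg₀-monOf π) (motzkins-length i π∈)))

weight-consMax : ∀ k n {ρ} → ρ ∈ motzkins n → weight k (consMax ρ) ≋ aMon (suc k) · weight k ρ
weight-consMax k n {ρ} ρ∈ = ≋-trans (shift^-cong k (monOf-consMax ρ (All.map proj₂ (IsPerm⇒InRange-length (proj₁ (motzkins-∈⁻ n ρ∈))))))
  (≋-trans (shift^-· k x₁ (monOf ρ)) (·-cong (≋-sym (aMon≋shift^x₁ k)) ≋-refl))

weight-splice : ∀ k i j {σ ρ} → σ ∈ motzkins i → ρ ∈ motzkins j → weight k (splice σ ρ) ≋ bMon (suc k) · weight (suc k) σ · weight k ρ
weight-splice k i j {σ} {ρ} σ∈ ρ∈ = ≋-trans (shift^-cong k (Splice.monOf-splice σ ρ (range i σ∈) (range j ρ∈)))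
  (≋-trans (shift^-· k (x₁²x₂ · shift (monOf σ)) (monOf ρ))
           (·-cong (≋-trans (shift^-· k x₁²x₂ (shift (monOf σ))) (·-cong (≋-sym (bMon≋shift^x₁²x₂ k)) ≋-refl)) ≋-refl))
  where
  range : ∀ n {π} → π ∈ motzkins n → InRange (length π) π
  range n π∈ = IsPerm⇒InRange-length (proj₁ (motzkins-∈⁻ n π∈))

-- The class counted by bₖ₊₁ Fₖ₊₁: left parts σ of splices, in x₁-degree |σ| + 2.
spliceLeft : ℕ → List (List ℕ)
spliceLeft (suc (suc i)) = motzkins i
spliceLeft _             = []

spliceLeftWeight : ℕ → List ℕ → Mon
spliceLeftWeight k σ = bMon (suc k) · weight (suc k) σ

spliceLeft-graded : ∀ k → Graded spliceLeft (spliceLeftWeight k)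
spliceLeft-graded k zero          = []
spliceLeft-graded k (suc zero)    = []
spliceLeft-graded k (suc (suc i)) = All.map (λ {σ} σ≡i → trans (deg-· 0 (bMon (suc k)) (weight (suc k) σ)) (cong₂ _+_ (deg₀-bMon k) σ≡i))
                                            (motzkins-graded (suc k) i)

bF≗countSeries : ∀ k d → (monoᴺ (bMon (suc k)) *ᴺ motzkinGF (suc k)) d ≡ countSeries spliceLeft (spliceLeftWeight k) d
bF≗countSeries k d with deg 0 d in d≡
... | zero          = monoᴺ-*ᴺ-below (bMon (suc k)) (motzkinGF (suc k)) d (subst₂ _<_ (sym d≡) (sym (deg₀-bMon k)) (s≤s z≤n))
... | suc zero      = monoᴺ-*ᴺ-below (bMon (suc k)) (motzkinGF (suc k)) d (subst₂ _<_ (sym d≡) (sym (deg₀-bMon k)) (s≤s (s≤s z≤n)))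
... | suc (suc i)   = trans (monoᴺ-*ᴺ-countSeries (bMon (suc k)) motzkins (weight (suc k)) (motzkins-graded (suc k)) (deg₀-bMon k) d
                                                  (subst (2 ≤_) (sym d≡) (s≤s (s≤s z≤n))))
                            (cong (λ e → count (λ σ → monEq (spliceLeftWeight k σ) d) (motzkins (e ∸ 2))) d≡)

tailGF-deg₀≡0 : ∀ k d → deg 0 d ≡ 0 → tailGF k d ≡ 0
tailGF-deg₀≡0 k d d≡0 = cong₂ _+_
  (monoᴺ-deg₀≢ (aMon (suc k)) d (λ a≡d → 1≢0 (trans (sym (deg₀-aMon k)) (trans a≡d d≡0))))
  (monoᴺ-*ᴺ-below (bMon (suc k)) (motzkinGF (suc k)) d (subst₂ _<_ (sym d≡0) (sym (deg₀-bMon k)) (s≤s z≤n)))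
  where
  1≢0 : 1 ≢ 0
  1≢0 ()

tailGF-noConstantTerm : ∀ k → NoConstantTerm (tailGF k)
tailGF-noConstantTerm k d tot≡0 = tailGF-deg₀≡0 k d (n≤0⇒n≡0 (subst (deg 0 d ≤_) tot≡0 (deg₀≤totDeg d)))

motzkinGF-fix-deg₀≡0 : ∀ k m → deg 0 m ≡ 0 → motzkinGF k m ≡ oneᴺ m + (tailGF k *ᴺ motzkinGF k) m
motzkinGF-fix-deg₀≡0 k m m≡0 = begin
  motzkinGF k m
    ≡⟨ cong (λ e → count (λ π → monEq (weight k π) m) (motzkins e)) m≡0 ⟩
  𝟙 (monEq (shift^ k []) m) + 0
    ≡⟨ +-identityʳ _ ⟩
  𝟙 (monEq (shift^ k []) m)
    ≡⟨ cong 𝟙 (monEq-congˡ m (shift^-[] k)) ⟩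
  oneᴺ m
    ≡⟨ +-identityʳ (oneᴺ m) ⟨
  oneᴺ m + 0
    ≡⟨ cong (oneᴺ m +_) (*ᴺ-zero-split {tailGF k} {motzkinGF k} m vanish) ⟨
  oneᴺ m + (tailGF k *ᴺ motzkinGF k) m
    ∎
  where
  open ≡-Reasoning
  vanish : ∀ d d′ → IsSplit m (d , d′) → tailGF k d * motzkinGF k d′ ≡ 0
  vanish d d′ (mkSplit deg₀ _) = cong (_* motzkinGF k d′)
    (tailGF-deg₀≡0 k d (n≤0⇒n≡0 (subst (deg 0 d ≤_) (trans deg₀ m≡0) (m≤m+n (deg 0 d) (deg 0 d′)))))

aF≡count-consMax : ∀ k m n → deg 0 m ≡ suc n →
  (monoᴺ (aMon (suc k)) *ᴺ motzkinGF k) m ≡ count (λ π → monEq (weight k π) m) (map consMax (motzkins n))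
aF≡count-consMax k m n m≡1+n = begin
  (monoᴺ (aMon (suc k)) *ᴺ motzkinGF k) m
    ≡⟨ monoᴺ-*ᴺ-countSeries (aMon (suc k)) motzkins (weight k) (motzkins-graded k) (deg₀-aMon k) m
                             (subst (1 ≤_) (sym m≡1+n) (s≤s z≤n)) ⟩
  count (λ ρ → monEq (aMon (suc k) · weight k ρ) m) (motzkins (deg 0 m ∸ 1))
    ≡⟨ cong (λ e → count (λ ρ → monEq (aMon (suc k) · weight k ρ) m) (motzkins (e ∸ 1))) m≡1+n ⟩
  count (λ ρ → monEq (aMon (suc k) · weight k ρ) m) (motzkins n)
    ≡⟨ count-cong-All (All.tabulate (λ ρ∈ → monEq-congˡ m (weight-consMax k n ρ∈))) ⟨
  count (Q ∘ consMax) (motzkins n)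
    ≡⟨ ∑-map (𝟙 ∘ Q) consMax (motzkins n) ⟨
  count Q (map consMax (motzkins n))
    ∎
  where
  open ≡-Reasoning
  Q : List ℕ → Bool
  Q π = monEq (weight k π) m

bFF≡count-splice : ∀ k m n → deg 0 m ≡ suc n →
  (monoᴺ (bMon (suc k)) *ᴺ motzkinGF (suc k) *ᴺ motzkinGF k) m ≡
  count (λ π → monEq (weight k π) m) (map (uncurry splice) (splicePairs n))
bFF≡count-splice k m n m≡1+n = begin
  (monoᴺ (bMon (suc k)) *ᴺ motzkinGF (suc k) *ᴺ motzkinGF k) m
    ≡⟨ *ᴺ-cong (bF≗countSeries k) (λ _ → refl) m ⟩
  (countSeries spliceLeft (spliceLeftWeight k) *ᴺ motzkinGF k) m
    ≡⟨ countSeries-*ᴺ spliceLeft motzkins (spliceLeftWeight k) (weight k) (spliceLeft-graded k) (motzkins-graded k) m ⟩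
  ∑ (term (deg 0 m)) (upTo (suc (deg 0 m)))
    ≡⟨ cong (λ e → ∑ (term e) (upTo (suc e))) m≡1+n ⟩
  ∑ (term (suc n)) (upTo (suc (suc n)))
    ≡⟨ trans (∑-upTo-sucˡ (term (suc n)) (suc n)) (∑-upTo-sucˡ (term (suc n) ∘ suc) n) ⟩
  ∑ (λ i → term (suc n) (suc (suc i))) (upTo n)
    ≡⟨ ∑-upTo-cong n (λ {i} _ → pairs≡ i) ⟩
  ∑ (λ i → ∑ (λ σ → count (λ ρ → Q (splice σ ρ)) (motzkins (n ∸ suc i))) (motzkins i)) (upTo n)
    ≡⟨ ∑-cong (upTo n) (λ i → trans (∑-cong (motzkins i) (λ σ → sym (∑-map (𝟙 ∘ Q ∘ uncurry splice) (σ ,_) (motzkins (n ∸ suc i)))))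
                                     (sym (∑-concatMap (𝟙 ∘ Q ∘ uncurry splice) _ (motzkins i)))) ⟩
  ∑ (λ i → count (Q ∘ uncurry splice) (concatMap (λ σ → map (σ ,_) (motzkins (n ∸ suc i))) (motzkins i))) (upTo n)
    ≡⟨ ∑-concatMap (𝟙 ∘ Q ∘ uncurry splice) _ (upTo n) ⟨
  count (Q ∘ uncurry splice) (splicePairs n)
    ≡⟨ ∑-map (𝟙 ∘ Q) (uncurry splice) (splicePairs n) ⟨
  count Q (map (uncurry splice) (splicePairs n))
    ∎
  where
  open ≡-Reasoning
  Q : List ℕ → Bool
  Q π = monEq (weight k π) m
  term : ℕ → ℕ → ℕ
  term e i = ∑ (λ σ → count (λ ρ → monEq (spliceLeftWeight k σ · weight k ρ) m) (motzkins (e ∸ i))) (spliceLeft i)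
  pairs≡ : ∀ i → term (suc n) (suc (suc i)) ≡ ∑ (λ σ → count (λ ρ → Q (splice σ ρ)) (motzkins (n ∸ suc i))) (motzkins i)
  pairs≡ i = ∑-cong-All (All.tabulate (λ {σ} σ∈ →
    count-cong-All {p = λ ρ → monEq (spliceLeftWeight k σ · weight k ρ) m} {q = λ ρ → Q (splice σ ρ)}
      (All.tabulate (λ ρ∈ → monEq-congˡ m (≋-sym (weight-splice k i (n ∸ suc i) σ∈ ρ∈))))))

motzkinGF-fix-deg₀≡suc : ∀ k m n → deg 0 m ≡ suc n → motzkinGF k m ≡ oneᴺ m + (tailGF k *ᴺ motzkinGF k) m
motzkinGF-fix-deg₀≡suc k m n m≡1+n = begin
  motzkinGF k m
    ≡⟨ cong (λ e → count Q (motzkins e)) m≡1+n ⟩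
  count Q (motzkins (suc n))
    ≡⟨ count-motzkins-suc n Q ⟩
  count Q (map consMax (motzkins n)) + count Q (map (uncurry splice) (splicePairs n))
    ≡⟨ cong₂ _+_ (aF≡count-consMax k m n m≡1+n) (bFF≡count-splice k m n m≡1+n) ⟨
  (monoᴺ (aMon (suc k)) *ᴺ motzkinGF k) m + (monoᴺ (bMon (suc k)) *ᴺ motzkinGF (suc k) *ᴺ motzkinGF k) m
    ≡⟨ *ᴺ-distribʳ-+ᴺ (monoᴺ (aMon (suc k))) (monoᴺ (bMon (suc k)) *ᴺ motzkinGF (suc k)) (motzkinGF k) m ⟨
  (tailGF k *ᴺ motzkinGF k) m
    ≡⟨ cong (_+ (tailGF k *ᴺ motzkinGF k) m) (monoᴺ-deg₀≢ [] m (λ 0≡m → 0≢1+n (trans 0≡m m≡1+n))) ⟨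
  oneᴺ m + (tailGF k *ᴺ motzkinGF k) m
    ∎
  where
  open ≡-Reasoning
  Q : List ℕ → Bool
  Q π = monEq (weight k π) m

motzkinGF-fix : ∀ k m → motzkinGF k m ≡ oneᴺ m + (tailGF k *ᴺ motzkinGF k) m
motzkinGF-fix k m = by-deg₀ (deg 0 m) refl
  where
  by-deg₀ : ∀ e → deg 0 m ≡ e → motzkinGF k m ≡ oneᴺ m + (tailGF k *ᴺ motzkinGF k) m
  by-deg₀ zero    m≡0   = motzkinGF-fix-deg₀≡0 k m m≡0
  by-deg₀ (suc n) m≡1+n = motzkinGF-fix-deg₀≡suc k m n m≡1+n

motzkinGF-unfold : ∀ k m → motzkinGF k m ≡ invOneMinusᴺ (tailGF k) m
motzkinGF-unfold k = invOneMinusᴺ-unique (tailGF k) (motzkinGF k) (tailGF-noConstantTerm k) (motzkinGF-fix k)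

open import Data.Integer using (+_)
import Data.Integer as ℤ using (ℤ; _+_; _*_)
import Data.Integer.Properties as ℤₚ

Lifts : Series → Seriesᴺ → Set
Lifts F f = ∀ m → F m ≡ + f m

sumℤ-map : ∀ (H : A → ℤ.ℤ) (h : A → ℕ) → (∀ x → H x ≡ + h x) → ∀ xs → sumℤ (map H xs) ≡ + ∑ h xs
sumℤ-map H h H≡h []       = refl
sumℤ-map H h H≡h (x ∷ xs) = trans (cong₂ ℤ._+_ (H≡h x) (sumℤ-map H h H≡h xs)) (sym (ℤₚ.pos-+ (h x) (∑ h xs)))

lifts-mono : ∀ e → Lifts (monoS e) (monoᴺ e)
lifts-mono e m with monEq e m
... | true  = refl
... | false = refl

lifts-+ : ∀ {F G f g} → Lifts F f → Lifts G g → Lifts (F +ˢ G) (f +ᴺ g)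
lifts-+ {f = f} {g = g} F≡f G≡g m = trans (cong₂ ℤ._+_ (F≡f m) (G≡g m)) (sym (ℤₚ.pos-+ (f m) (g m)))

lifts-* : ∀ {F G f g} → Lifts F f → Lifts G g → Lifts (F *ˢ G) (f *ᴺ g)
lifts-* {F} {G} {f} {g} F≡f G≡g m = sumℤ-map (λ p → F (proj₁ p) ℤ.* G (proj₂ p)) (λ p → f (proj₁ p) * g (proj₂ p))
  (λ p → trans (cong₂ ℤ._*_ (F≡f (proj₁ p)) (G≡g (proj₂ p))) (sym (ℤₚ.pos-* (f (proj₁ p)) (g (proj₂ p))))) (splits m)

lifts-^ : ∀ {G g} → Lifts G g → ∀ k → Lifts (G ^ˢ k) (g ^ᴺ k)
lifts-^ G≡g zero    = lifts-mono []
lifts-^ G≡g (suc k) = lifts-* G≡g (lifts-^ G≡g k)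

lifts-invOneMinus : ∀ {G g} → Lifts G g → Lifts (invOneMinus G) (invOneMinusᴺ g)
lifts-invOneMinus {G} {g} G≡g m =
  sumℤ-map (λ k → (G ^ˢ k) m) (λ k → (g ^ᴺ k) m) (λ k → lifts-^ G≡g k m) (upTo (suc (totDeg m)))

lifts-cfTail : ∀ d k → Lifts (cfTail d k) (cfTailᴺ d k)
lifts-cfTail zero    k = lifts-mono (aMon k)
lifts-cfTail (suc d) k = lifts-+ (lifts-mono (aMon k)) (lifts-* (lifts-mono (bMon k)) (lifts-invOneMinus (lifts-cfTail d (suc k))))

theorem3p2 : (m : Mon) → ∃ λ N₀ → (N : ℕ) → N ≥ N₀ →
    convergent N m ≡ + lhsCoeff m
theorem3p2 m = exp₁ m , λ N N≥m → begin
  convergent N m                    ≡⟨ lifts-invOneMinus (lifts-cfTail N 1) m ⟩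
  + invOneMinusᴺ (cfTailᴺ N 1) m    ≡⟨ cong +_ (convergent-agrees N m (deg₀≤ N N≥m)) ⟩
  + motzkinGF 0 m                   ≡⟨ cong +_ (lhsCoeff≡motzkinGF m) ⟨
  + lhsCoeff m                      ∎
  where
  open ≡-Reasoning
  open Convergents motzkinGF motzkinGF-unfold
  deg₀≤ : ∀ N → N ≥ exp₁ m → deg 0 m ≤ suc (N + N)
  deg₀≤ N N≥m = ≤-trans (subst (_≤ N) (exp₁≡deg₀ m) N≥m) (m≤n⇒m≤1+n (m≤m+n N N))
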